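{- Let $\mathfrak{z}$ be the $\mathbb{Q}$-span of the $y_{s,0}$ ($s\ge1$), $z\in\mathfrak{z}$ and $u$ a formal variable. Then in $\mathfrak{A}^1[[u]]$ $$\exp_*(zu)=\big(2-\exp_{\circ}(zu)\big)^{ -1},$$ and, in the weight-completion of $\mathfrak{A}^1$, $$\exp_*\big(\log_\circ(1+z)\big)=(1-z)^{ -1}.$$
   Context: Fix an integer $N\ge1$; indices read modulo $N$. Let $\mathfrak{A}=\mathbb{Q}\langle a,b_0,\dots,b_{N-1}\rangle$ (concatenation as juxtaposition, unit $\mathbf{1}=1$), graded by weight = number of letters; $y_{s,i}=a^{s-1}b_i$; $\mathfrak{A}^1$ is the span of words not ending in $a$. For an integer $j$, $\tau_j(y_{s_1,i_1}\cdots y_{s_n,i_n})=y_{s_1,i_1+j}\cdots y_{s_n,i_n+j}$, $\tau_j(\mathbf{1})=\mathbf{1}$. The stuffle product $*$ on $\mathfrak{A}^1$: bilinear, $\mathbf{1}*w=w*\mathbf{1}=w$, $y_{s,j}\omega_1*y_{t,k}\omega_2=y_{s,j}\tau_j(\tau_{ -j}(\omega_1)*y_{t,k}\omega_2)+y_{t,k}\tau_k(y_{s,j}\omega_1*\tau_{ -k}(\omega_2))+y_{s+t,j+k}\tau_{j+k}(\tau_{ -j}(\omega_1)*\tau_{ -k}(\omega_2))$. On $\mathfrak{z}$ define $z\circ z'=z*z'-zz'-z'z$ (so $y_{s,0}\circ y_{t,0}=y_{s+t,0}$). Notation: $\exp_*(x)=\sum_{n\ge0}x^{*n}/n!$; $\exp_\circ(x)=1+\sum_{n\ge1}x^{\circ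 n}/n!$; $\log_\circ(1+z)=\sum_{n\ge1}(-1)^{n-1}z^{\circ n}/n$; $(2-\exp_\circ(zu))^{ -1}$ and $(1-z)^{ -1}=\sum_{n\ge0}z^n$ are inverses for the concatenation product. Infinite sums are taken in $\mathfrak{A}^1[[u]]$ or in the completion of $\mathfrak{A}^1$ with respect to weight. -}

module Defs where

open import Data.Nat as ℕ using (ℕ; zero; suc; NonZero; _≤_; _!)
open import Data.Nat.Properties using (_!≢0)
open import Data.Nat.DivMod using (_mod_)
open import Data.Fin using (Fin; toℕ)
import Data.Fin.Properties as FinP
import Data.Nat.Properties as ℕP
open import Data.Rational as ℚ using (ℚ; 0ℚ; 1ℚ)
open import Data.Integer using (+_; -[1+_])
open import Data.List using (List; []; _∷_; _++_; map; concatMap; length; foldr; upTo; zip)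
import Data.List.Properties as ListP
open import Data.Product using (_×_; _,_; ∃)
import Data.Product.Properties as ProdP
open import Relation.Nullary using (yes; no)
open import Relation.Binary.PropositionalEquality using (_≡_)

-- Everything is parametrised by N ≥ 1 (as an instance NonZero N).
-- 𝔄¹ is identified with the free ℚ-algebra on the letters
-- y_{s,i} = a^{s-1} b_i  (s ≥ 1, i ∈ ℤ/N).  A letter y_{s,i} is stored
-- as the pair (s - 1 , i) : ℕ × Fin N.

module _ (N : ℕ) {{nz : NonZero N}} where

  Letter : Set
  Letter = ℕ × Fin N

  Word : Set
  Word = List Letter

  -- elements of 𝔄¹ : finite formal ℚ-linear combinations of words
  A : Set
  A = List (ℚ × Word)

  _≟W_ : (v w : Word) → Relation.Nullary.Dec (v ≡ w)
  _≟W_ = ListP.≡-dec (ProdP.≡-dec ℕP._≟_ FinP._≟_)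

  coeff : A → Word → ℚ
  coeff [] w = 0ℚ
  coeff ((c , v) ∷ x) w with v ≟W w
  ... | yes _ = c ℚ.+ coeff x w
  ... | no _  = coeff x w

  _≈_ : A → A → Set
  x ≈ y = ∀ w → coeff x w ≡ coeff y w

  zeroA oneA : A
  zeroA = []
  oneA = (1ℚ , []) ∷ []

  single : Word → A
  single w = (1ℚ , w) ∷ []

  _+A_ : A → A → A
  x +A y = x ++ y

  _·A_ : ℚ → A → A
  c ·A x = map (λ { (d , w) → (c ℚ.* d , w) }) x

  _-A_ : A → A → A
  x -A y = x +A ((ℚ.- 1ℚ) ·A y)

  sumA : List A → A
  sumA = foldr _+A_ zeroA

  _⊗_ : A → A → A
  x ⊗ y = concatMap (λ { (c , w) → map (λ { (d , v) → (c ℚ.* d , w ++ v) }) y }) x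

  _+F_ : Fin N → Fin N → Fin N
  i +F j = (toℕ i ℕ.+ toℕ j) mod N

  negF : Fin N → Fin N
  negF j = (N ℕ.∸ toℕ j) mod N

  τ : Fin N → Word → Word
  τ j = map (λ { (s , i) → (s , i +F j) })

  τA : Fin N → A → A
  τA j = map (λ { (c , w) → (c , τ j w) })

  [_] : Letter → A
  [ l ] = single (l ∷ [])

  -- stuffle of words, by the recursion in the paper; the first argument is
  -- fuel (≥ total length suffices).
  stF : ℕ → Word → Word → A
  stF _ [] w = single w
  stF _ (l ∷ w) [] = single (l ∷ w)
  stF zero (_ ∷ _) (_ ∷ _) = zeroA
  stF (suc f) ((s , j) ∷ w₁) ((t , k) ∷ w₂) =
       ([ (s , j) ] ⊗ τA j (stF f (τ (negF j) w₁) ((t , k) ∷ w₂)))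
    +A (([ (t , k) ] ⊗ τA k (stF f ((s , j) ∷ w₁) (τ (negF k) w₂)))
    +A ([ (suc (s ℕ.+ t) , j +F k) ] ⊗ τA (j +F k) (stF f (τ (negF j) w₁) (τ (negF k) w₂))))

  stW : Word → Word → A
  stW v w = stF (length v ℕ.+ length w) v w

  _*_ : A → A → A
  x * y = concatMap (λ { (c , v) → concatMap (λ { (d , w) → (c ℚ.* d) ·A stW v w }) y }) x

  _∘_ : A → A → A
  x ∘ y = ((x * y) -A (x ⊗ y)) -A (y ⊗ x)

  -- powers: z^{*n} (z^{*0} = 1), z^{∘n} (n ≥ 1; z^{∘0} := 1), zⁿ (concatenation)
  starPow : ℕ → A → A
  starPow zero z = oneA
  starPow (suc n) z = z * starPow n z

  circPow : ℕ → A → A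
  circPow zero z = oneA
  circPow (suc zero) z = z
  circPow (suc (suc n)) z = circPow (suc n) z ∘ z

  catPow : ℕ → A → A
  catPow zero z = oneA
  catPow (suc n) z = z ⊗ catPow n z

  -- 𝔷 = ℚ-span of the y_{s,0}: cs = (c₁ , c₂ , …) gives Σ_s c_s y_{s,0}
  zero' : Fin N
  zero' = 0 mod N

  zetaElt : List ℚ → A
  zetaElt cs = map (λ { (s , c) → (c , ((s , zero') ∷ [])) }) (zip (upTo (length cs)) cs)

  _∈𝔷 : A → Set
  z ∈𝔷 = ∃ λ cs → z ≈ zetaElt cs

  weight : Word → ℕ
  weight = foldr (λ { (s , _) r → suc s ℕ.+ r }) 0

  trunc : ℕ → A → A
  trunc W [] = []
  trunc W ((c , w) ∷ x) with weight w ℕ.≤? W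
  ... | yes _ = (c , w) ∷ trunc W x
  ... | no _ = trunc W x

  -- Formal power series in u with coefficients in 𝔄¹ (coefficient of uⁿ)
  PS : Set
  PS = ℕ → A

  _≈P_ : PS → PS → Set
  f ≈P g = ∀ n → f n ≈ g n

  oneP : PS
  oneP zero = oneA
  oneP (suc _) = zeroA

  -- concatenation (Cauchy) product; u is central
  mulPS : PS → PS → PS
  mulPS f g n = sumA (map (λ k → f k ⊗ g (n ℕ.∸ k)) (upTo (suc n)))

  invFact : ℕ → ℚ
  invFact n = (+ 1 ℚ./ (n !)) {{n !≢0}}

  expStarPS : A → PS
  expStarPS z n = invFact n ·A starPow n z

  expCircPS : A → PS
  expCircPS z n = invFact n ·A circPow n z

  twoMinusExpCirc : A → PS
  twoMinusExpCirc z n = ((+ 2 ℚ./ 1) ·A oneP n) -A expCircPS z n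

  IsInverseP : PS → PS → Set
  IsInverseP X F = (mulPS X F ≈P oneP) × (mulPS F X ≈P oneP)

  sgn : ℕ → ℚ
  sgn zero = 1ℚ
  sgn (suc j) = ℚ.- sgn j

  -- Σ_{k=1}^{n} (-1)^{k-1} z^{∘k} / k   (partial sums of log_∘(1+z))
  logPart : ℕ → A → A
  logPart n z = sumA (map (λ j → (sgn j ℚ.* (+ 1 ℚ./ suc j)) ·A circPow (suc j) z) (upTo n))

  -- Σ_{k=0}^{m} x^{*k} / k!   (partial sums of exp_*(x))
  expPart : ℕ → A → A
  expPart m x = sumA (map (λ k → invFact k ·A starPow k x) (upTo (suc m)))

  -- Σ_{k=0}^{p} z^k   (partial sums of (1-z)^{-1})
  geoPart : ℕ → A → A
  geoPart p z = sumA (map (λ k → catPow k z) (upTo (suc p)))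

-- For letters c, y of 𝔷 the stuffle recursion reads c * (y w) = c y w + y (c * w) + (c ⋄ y) w, where
-- ⋄ is the commutative, associative merge y_{s,0} ⋄ y_{t,0} = y_{s+t,0}; on 𝔷 it coincides with ∘.
-- Expanding z^{*(m+1)} with this rule gives a binomial identity which, after dividing by factorials,
-- says a = 1 + G a for a = exp_*(zu) and G = exp_⋄(zu) - 1.  As G has no constant term, 1 - G,
-- which is 2 - exp_∘(zu), is then a two-sided inverse of a.
--
-- For the second identity let L = log_∘(1+z) and E = exp_⋄(L) - 1, so that exp_*(L) = 1 + E exp_*(L)
-- by the first part.  The Euler operator θ (each word times its weight) is a derivation of ⋄, and
-- a telescoping sum gives θL + z ⋄ θL = θz.  Hence E and z both solve θe + z ⋄ θe = θz + e ⋄ θz,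
-- whose solutions without constant term are unique since θ multiplies the weight-k part by k.
-- So E = z and exp_*(L) = 1 + z exp_*(L), the equation characterising (1 - z)^{-1}.  Everything is
-- done with partial sums compared up to a weight W: elements of 𝔷 have weight at least 1, so
-- high-index terms do not reach weight W.

module Submission where

open import Defs
open import Data.Nat using (ℕ; NonZero; _≤_)
open import Data.Product using (_×_; ∃)
open import Data.Nat as ℕ using (zero; suc; _+_; _∸_; _<_; z≤n; s≤s; _!)
import Data.Nat.Properties as ℕP
import Data.Nat.Solver as ℕ-Solver
open import Data.Nat.DivMod using (_%_; n%n≡0; m<n⇒m%n≡m)
open import Data.Fin using (Fin; toℕ)
import Data.Fin.Properties as FinP
import Data.Integer as ℤ
import Data.Integer.Properties as ℤP
open import Data.Rational as ℚ using (ℚ; 0ℚ; 1ℚ; _/_; toℚᵘ)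
import Data.Rational.Properties as ℚP
open import Data.Rational.Unnormalised as ℚᵘ using (mkℚᵘ; *≡*)
import Data.Rational.Unnormalised.Properties as ℚᵘP
open import Data.Rational.Solver
open import Data.List using ([]; _∷_; _++_; map; concatMap; length; upTo; applyUpTo)
import Data.List.Properties as ListP
open import Data.List.Relation.Unary.All using (All; []; _∷_)
open import Data.Product using (Σ; _,_; proj₁; proj₂)
open import Data.Sum using (_⊎_; inj₁; inj₂)
open import Relation.Nullary using (Dec; yes; no; ¬_)
open import Relation.Binary.PropositionalEquality
open import Relation.Binary.Bundles using (Setoid)
open import Data.Empty using (⊥-elim)
open import Level using (0ℓ)
import Relation.Binary.Reasoning.Setoid as SR

fromℕ : ℕ → ℚ
fromℕ n = ℤ.+ n / 1

private
  toℚᵘ-fromℕ : ∀ n → toℚᵘ (fromℕ n) ℚᵘ.≃ mkℚᵘ (ℤ.+ n) 0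
  toℚᵘ-fromℕ n = ℚP.toℚᵘ-fromℚᵘ (mkℚᵘ (ℤ.+ n) 0)

fromℕ-+ : ∀ a b → fromℕ (a + b) ≡ fromℕ a ℚ.+ fromℕ b
fromℕ-+ a b = ℚP.toℚᵘ-injective (ℚᵘP.≃-trans (toℚᵘ-fromℕ (a + b)) (ℚᵘP.≃-sym
  (ℚᵘP.≃-trans (ℚP.toℚᵘ-homo-+ (fromℕ a) (fromℕ b)) (ℚᵘP.≃-trans (ℚᵘP.+-cong (toℚᵘ-fromℕ a) (toℚᵘ-fromℕ b)) (*≡* cross-multiplied)))))
  where
  cross-multiplied : ((ℤ.+ a ℤ.* ℤ.+ 1) ℤ.+ (ℤ.+ b ℤ.* ℤ.+ 1)) ℤ.* ℤ.+ 1 ≡ ℤ.+ (a + b) ℤ.* ℤ.+ (1 ℕ.* 1)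
  cross-multiplied rewrite ℤP.*-identityʳ (ℤ.+ a) | ℤP.*-identityʳ (ℤ.+ b) | ℤP.*-identityʳ (ℤ.+ a ℤ.+ ℤ.+ b) = refl

fromℕ-* : ∀ a b → fromℕ (a ℕ.* b) ≡ fromℕ a ℚ.* fromℕ b
fromℕ-* a b = ℚP.toℚᵘ-injective (ℚᵘP.≃-trans (toℚᵘ-fromℕ (a ℕ.* b)) (ℚᵘP.≃-sym
  (ℚᵘP.≃-trans (ℚP.toℚᵘ-homo-* (fromℕ a) (fromℕ b)) (ℚᵘP.≃-trans (ℚᵘP.*-cong (toℚᵘ-fromℕ a) (toℚᵘ-fromℕ b)) (*≡* cross-multiplied)))))
  where
  cross-multiplied : (ℤ.+ a ℤ.* ℤ.+ b) ℤ.* ℤ.+ 1 ≡ ℤ.+ (a ℕ.* b) ℤ.* ℤ.+ (1 ℕ.* 1)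
  cross-multiplied rewrite ℤP.*-identityʳ (ℤ.+ a ℤ.* ℤ.+ b) | ℤP.*-identityʳ (ℤ.+ (a ℕ.* b)) = sym (ℤP.pos-* a b)

*-inverseˡ-fromℕ : ∀ a .{{_ : NonZero a}} → (ℤ.+ 1 / a) ℚ.* fromℕ a ≡ 1ℚ
*-inverseˡ-fromℕ (suc k) = ℚP.toℚᵘ-injective (ℚᵘP.≃-trans (ℚP.toℚᵘ-homo-* (ℤ.+ 1 / suc k) (fromℕ (suc k)))
  (ℚᵘP.≃-trans (ℚᵘP.*-cong (ℚP.toℚᵘ-fromℚᵘ (mkℚᵘ (ℤ.+ 1) k)) (toℚᵘ-fromℕ (suc k))) (*≡* cross-multiplied)))
  where
  cross-multiplied : (ℤ.+ 1 ℤ.* ℤ.+ suc k) ℤ.* ℤ.+ 1 ≡ ℤ.+ 1 ℤ.* ℤ.+ (suc k ℕ.* 1)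
  cross-multiplied rewrite ℕP.*-identityʳ k | ℕP.*-identityʳ (k + 0) = refl

binomial : ℕ → ℕ → ℕ
binomial zero j = 1
binomial (suc i) zero = 1
binomial (suc i) (suc j) = binomial i (suc j) + binomial (suc i) j

binomial-factorial : ∀ i j → binomial i j ℕ.* (i ! ℕ.* j !) ≡ (i + j) !
binomial-factorial zero j = trans (ℕP.*-identityˡ _) (ℕP.+-identityʳ _)
binomial-factorial (suc i) zero = trans (ℕP.*-identityˡ _) (trans (ℕP.*-identityʳ _) (cong _! (sym (ℕP.+-identityʳ (suc i)))))
binomial-factorial (suc i) (suc j) = begin
    (B₁ + B₂) ℕ.* ((suc i ℕ.* i!) ℕ.* (suc j ℕ.* j!))
  ≡⟨ solve 6 (λ B₁ B₂ i j i! j! → (B₁ :+ B₂) :* (((con 1 :+ i) :* i!) :* ((con 1 :+ j) :* j!))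
                                  := (con 1 :+ i) :* (B₁ :* (i! :* ((con 1 :+ j) :* j!))) :+ (con 1 :+ j) :* (B₂ :* (((con 1 :+ i) :* i!) :* j!)))
             refl B₁ B₂ i j i! j! ⟩
    suc i ℕ.* (B₁ ℕ.* (i! ℕ.* (suc j ℕ.* j!))) + suc j ℕ.* (B₂ ℕ.* ((suc i ℕ.* i!) ℕ.* j!))
  ≡⟨ cong₂ (λ p q → suc i ℕ.* p + suc j ℕ.* q) (trans (binomial-factorial i (suc j)) (cong _! (ℕP.+-suc i j))) (binomial-factorial (suc i) j) ⟩
    suc i ℕ.* K + suc j ℕ.* K
  ≡⟨ solve 3 (λ i j K → (con 1 :+ i) :* K :+ (con 1 :+ j) :* K := (con 2 :+ (i :+ j)) :* K) refl i j K ⟩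
    suc (suc (i + j)) ℕ.* K
  ≡⟨ cong (λ q → suc q !) (sym (ℕP.+-suc i j)) ⟩
    (suc i + suc j) !
  ∎
  where
  open ≡-Reasoning
  open ℕ-Solver.+-*-Solver
  B₁ B₂ i! j! K : ℕ
  B₁ = binomial i (suc j)
  B₂ = binomial (suc i) j
  i! = i !
  j! = j !
  K = suc (i + j) !

reciprocal-rescale : ∀ u b p q {X Y K} → u ℚ.* K ≡ 1ℚ → p ℚ.* X ≡ 1ℚ → q ℚ.* Y ≡ 1ℚ → b ℚ.* (X ℚ.* Y) ≡ K → u ℚ.* b ≡ p ℚ.* q
reciprocal-rescale u b p q {X} {Y} {K} u*K≡1 p*X≡1 q*Y≡1 b*X*Y≡K = begin
    u ℚ.* b
  ≡⟨ solve 2 (λ u b → u :* b := (u :* b) :* (con 1ℚ :* con 1ℚ)) refl u b ⟩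
    (u ℚ.* b) ℚ.* (1ℚ ℚ.* 1ℚ)
  ≡⟨ cong₂ (λ s t → (u ℚ.* b) ℚ.* (s ℚ.* t)) (sym p*X≡1) (sym q*Y≡1) ⟩
    (u ℚ.* b) ℚ.* ((p ℚ.* X) ℚ.* (q ℚ.* Y))
  ≡⟨ solve 6 (λ u b p q X Y → (u :* b) :* ((p :* X) :* (q :* Y)) := (u :* (b :* (X :* Y))) :* (p :* q)) refl u b p q X Y ⟩
    (u ℚ.* (b ℚ.* (X ℚ.* Y))) ℚ.* (p ℚ.* q)
  ≡⟨ cong (λ s → (u ℚ.* s) ℚ.* (p ℚ.* q)) b*X*Y≡K ⟩
    (u ℚ.* K) ℚ.* (p ℚ.* q)
  ≡⟨ cong (ℚ._* (p ℚ.* q)) u*K≡1 ⟩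
    1ℚ ℚ.* (p ℚ.* q)
  ≡⟨ ℚP.*-identityˡ (p ℚ.* q) ⟩
    p ℚ.* q
  ∎
  where
  open ≡-Reasoning
  open +-*-Solver

module FreeModule (N : ℕ) {{nz : NonZero N}} where
  open +-*-Solver

  𝔸 Wd : Set
  𝔸 = A N
  Wd = Word N

  _⊕_ : 𝔸 → 𝔸 → 𝔸
  _⊕_ = _+A_ N
  infixl 6 _⊕_

  _·_ : ℚ → 𝔸 → 𝔸
  _·_ = _·A_ N
  infixr 7 _·_

  𝟘 𝟙 : 𝔸
  𝟘 = zeroA N
  𝟙 = oneA N

  word : Wd → 𝔸
  word = single N

  cf : 𝔸 → Wd → ℚ
  cf = coeff N

  _≟w_ : (v w : Wd) → Dec (v ≡ w)
  _≟w_ = _≟W_ N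

  record _≃_ (x y : 𝔸) : Set where
    constructor ⟨_⟩
    field at : ∀ w → cf x w ≡ cf y w
  open _≃_ public
  infix 4 _≃_

  ≃-refl : ∀ {x} → x ≃ x
  ≃-refl = ⟨ (λ w → refl) ⟩
  ≃-sym : ∀ {x y} → x ≃ y → y ≃ x
  ≃-sym p = ⟨ (λ w → sym (at p w)) ⟩
  ≃-trans : ∀ {x y z} → x ≃ y → y ≃ z → x ≃ z
  ≃-trans p q = ⟨ (λ w → trans (at p w) (at q w)) ⟩

  ≃-setoid : Setoid 0ℓ 0ℓ
  ≃-setoid = record { Carrier = 𝔸 ; _≈_ = _≃_ ; isEquivalence = record { refl = ≃-refl ; sym = ≃-sym ; trans = ≃-trans } }

  ≡⇒≃ : ∀ {x y} → x ≡ y → x ≃ y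
  ≡⇒≃ refl = ≃-refl

  cf-∷-≢ : ∀ c v x w → ¬ (v ≡ w) → cf ((c , v) ∷ x) w ≡ cf x w
  cf-∷-≢ c v x w v≢w with v ≟w w
  ... | yes v≡w = ⊥-elim (v≢w v≡w)
  ... | no _ = refl

  cf-∷-cong : ∀ c v {x y} w → cf x w ≡ cf y w → cf ((c , v) ∷ x) w ≡ cf ((c , v) ∷ y) w
  cf-∷-cong c v w e with v ≟w w
  ... | yes _ = cong (c ℚ.+_) e
  ... | no _ = e

  cf-⊕ : ∀ x y w → cf (x ⊕ y) w ≡ cf x w ℚ.+ cf y w
  cf-⊕ [] y w = sym (ℚP.+-identityˡ _)
  cf-⊕ ((c , v) ∷ x) y w with v ≟w w
  ... | yes _ = trans (cong (c ℚ.+_) (cf-⊕ x y w)) (sym (ℚP.+-assoc c _ _))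
  ... | no _ = cf-⊕ x y w

  cf-· : ∀ c x w → cf (c · x) w ≡ c ℚ.* cf x w
  cf-· c [] w = sym (ℚP.*-zeroʳ c)
  cf-· c ((d , v) ∷ x) w with v ≟w w
  ... | yes _ = trans (cong (c ℚ.* d ℚ.+_) (cf-· c x w)) (sym (ℚP.*-distribˡ-+ c d _))
  ... | no _ = cf-· c x w

  ⊕-cong : ∀ {x x' y y'} → x ≃ x' → y ≃ y' → x ⊕ y ≃ x' ⊕ y'
  ⊕-cong {x} {x'} {y} {y'} p q = ⟨ (λ w → trans (cf-⊕ x y w) (trans (cong₂ ℚ._+_ (at p w) (at q w)) (sym (cf-⊕ x' y' w)))) ⟩

  ·-cong : ∀ c {x x'} → x ≃ x' → c · x ≃ c · x'
  ·-cong c {x} {x'} p = ⟨ (λ w → trans (cf-· c x w) (trans (cong (c ℚ.*_) (at p w)) (sym (cf-· c x' w)))) ⟩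

  ·-congˡ : ∀ {c d} x → c ≡ d → c · x ≃ d · x
  ·-congˡ x refl = ≃-refl

  ⊕-assoc : ∀ x y z → (x ⊕ y) ⊕ z ≃ x ⊕ (y ⊕ z)
  ⊕-assoc x y z = ≡⇒≃ (ListP.++-assoc x y z)

  ⊕-identityˡ : ∀ x → 𝟘 ⊕ x ≃ x
  ⊕-identityˡ x = ≃-refl
  ⊕-identityʳ : ∀ x → x ⊕ 𝟘 ≃ x
  ⊕-identityʳ x = ≡⇒≃ (ListP.++-identityʳ x)

  ·-distribˡ-⊕ : ∀ c x y → c · (x ⊕ y) ≃ c · x ⊕ c · y
  ·-distribˡ-⊕ c x y = ≡⇒≃ (ListP.map-++ _ x y)

  ·-assoc  : ∀ c d x → c · (d · x) ≃ (c ℚ.* d) · x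
  ·-assoc c d x = ⟨ (λ w → trans (cf-· c (d · x) w)
      (trans (cong (c ℚ.*_) (cf-· d x w)) (trans (sym (ℚP.*-assoc c d (cf x w))) (sym (cf-· (c ℚ.* d) x w))))) ⟩

  ·-distribʳ-+ : ∀ c d x → (c ℚ.+ d) · x ≃ c · x ⊕ d · x
  ·-distribʳ-+ c d x = ⟨
      (λ w → trans (cf-· (c ℚ.+ d) x w)
      (trans (ℚP.*-distribʳ-+ (cf x w) c d) (sym (trans (cf-⊕ (c · x) (d · x) w) (cong₂ ℚ._+_ (cf-· c x w) (cf-· d x w)))))) ⟩

  ·-identityˡ : ∀ x → 1ℚ · x ≃ x
  ·-identityˡ x = ⟨ (λ w → trans (cf-· 1ℚ x w) (ℚP.*-identityˡ (cf x w))) ⟩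

  _⊖_ : 𝔸 → 𝔸 → 𝔸
  x ⊖ y = _-A_ N x y
  infixl 6 _⊖_

  ⊖-cong : ∀ {x x' y y'} → x ≃ x' → y ≃ y' → x ⊖ y ≃ x' ⊖ y'
  ⊖-cong {x} {x'} {y} {y'} p q = ⊕-cong {x} {x'} p (·-cong (ℚ.- 1ℚ) q)

  cf-⊖ : ∀ x y w → cf (x ⊖ y) w ≡ cf x w ℚ.- cf y w
  cf-⊖ x y w = trans (cf-⊕ x _ w) (cong (cf x w ℚ.+_) (trans (cf-· (ℚ.- 1ℚ) y w) (solve 1 (λ a → (:- con 1ℚ) :* a := :- a) refl (cf y w))))

  Λ : (Wd → ℚ) → 𝔸 → ℚ
  Λ g [] = 0ℚ
  Λ g ((c , v) ∷ x) = c ℚ.* g v ℚ.+ Λ g x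

  Lin : (Wd → 𝔸) → 𝔸 → 𝔸
  Lin f x = concatMap (λ { (c , v) → c · f v }) x

  cf-Lin : ∀ f x w → cf (Lin f x) w ≡ Λ (λ v → cf (f v) w) x
  cf-Lin f [] w = refl
  cf-Lin f ((c , v) ∷ x) w = trans (cf-⊕ (c · f v) (Lin f x) w) (cong₂ ℚ._+_ (cf-· c (f v) w) (cf-Lin f x w))

  Λ-⊕ : ∀ g x y → Λ g (x ⊕ y) ≡ Λ g x ℚ.+ Λ g y
  Λ-⊕ g [] y = sym (ℚP.+-identityˡ _)
  Λ-⊕ g ((c , v) ∷ x) y = trans (cong (c ℚ.* g v ℚ.+_) (Λ-⊕ g x y)) (sym (ℚP.+-assoc (c ℚ.* g v) (Λ g x) (Λ g y)))

  Λ-· : ∀ g d x → Λ g (d · x) ≡ d ℚ.* Λ g x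
  Λ-· g d [] = sym (ℚP.*-zeroʳ d)
  Λ-· g d ((c , v) ∷ x) = trans (cong₂ ℚ._+_ (ℚP.*-assoc d c _) (Λ-· g d x)) (sym (ℚP.*-distribˡ-+ d _ _))

  Λ-ext : ∀ {g g'} x → (∀ v → g v ≡ g' v) → Λ g x ≡ Λ g' x
  Λ-ext [] e = refl
  Λ-ext ((c , v) ∷ x) e = cong₂ (λ a b → c ℚ.* a ℚ.+ b) (e v) (Λ-ext x e)

  Λ-lin : ∀ (g g' : Wd → ℚ) a x → Λ (λ v → a ℚ.* g v ℚ.+ g' v) x ≡ a ℚ.* Λ g x ℚ.+ Λ g' x
  Λ-lin g g' a [] = solve 1 (λ a → con 0ℚ := a :* con 0ℚ :+ con 0ℚ) refl a
  Λ-lin g g' a ((c , v) ∷ x) = trans (cong (c ℚ.* (a ℚ.* g v ℚ.+ g' v) ℚ.+_) (Λ-lin g g' a x))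
     (solve 6 (λ c a gv g'v L L' → c :* (a :* gv :+ g'v) :+ (a :* L :+ L') := a :* (c :* gv :+ L) :+ (c :* g'v :+ L')) refl c a (g v) (g' v)
         (Λ g x) (Λ g' x))

  Λ-0 : ∀ x → Λ (λ _ → 0ℚ) x ≡ 0ℚ
  Λ-0 [] = refl
  Λ-0 ((c , v) ∷ x) = cong₂ ℚ._+_ (ℚP.*-zeroʳ c) (Λ-0 x)

  Λ-swap : ∀ (G : Wd → Wd → ℚ) x y → Λ (λ v → Λ (G v) y) x ≡ Λ (λ u → Λ (λ v → G v u) x) y
  Λ-swap G [] y = sym (Λ-0 y)
  Λ-swap G ((c , v) ∷ x) y = trans (cong (c ℚ.* Λ (G v) y ℚ.+_) (Λ-swap G x y)) (sym (Λ-lin (G v) (λ u → Λ (λ v₁ → G v₁ u) x) c y))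

  Λ-scale : ∀ a g x → Λ (λ v → a ℚ.* g v) x ≡ a ℚ.* Λ g x
  Λ-scale a g x = trans (Λ-ext x (λ v → sym (ℚP.+-identityʳ (a ℚ.* g v))))
    (trans (Λ-lin g (λ _ → 0ℚ) a x) (trans (cong (a ℚ.* Λ g x ℚ.+_) (Λ-0 x)) (ℚP.+-identityʳ (a ℚ.* Λ g x))))

  removeWord : Wd → 𝔸 → 𝔸
  removeWord u [] = []
  removeWord u ((c , v) ∷ x) with v ≟w u
  ... | yes _ = removeWord u x
  ... | no _ = (c , v) ∷ removeWord u x

  Λ-split : ∀ g u x → Λ g x ≡ cf x u ℚ.* g u ℚ.+ Λ g (removeWord u x)
  Λ-split g u [] = sym (cong (ℚ._+ 0ℚ) (ℚP.*-zeroˡ (g u)))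
  Λ-split g u ((c , v) ∷ x) with v ≟w u
  ... | yes refl = trans (cong (c ℚ.* g v ℚ.+_) (Λ-split g u x))
          (solve 4 (λ c g a r → c :* g :+ (a :* g :+ r) := (c :+ a) :* g :+ r) refl c (g v) (cf x u) (Λ g (removeWord u x)))
  ... | no _ = trans (cong (c ℚ.* g v ℚ.+_) (Λ-split g u x))
          (solve 4 (λ c g a r → c :+ (a :* g :+ r) := a :* g :+ (c :+ r)) refl (c ℚ.* g v) (g u) (cf x u) (Λ g (removeWord u x)))

  cf-removeWord-self : ∀ u x → cf (removeWord u x) u ≡ 0ℚ
  cf-removeWord-self u [] = refl
  cf-removeWord-self u ((c , v) ∷ x) with v ≟w u
  ... | yes _ = cf-removeWord-self u x
  ... | no v≢u with v ≟w u
  ...   | yes e = ⊥-elim (v≢u e)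
  ...   | no _ = cf-removeWord-self u x

  cf-removeWord-other : ∀ u x w → ¬ (w ≡ u) → cf (removeWord u x) w ≡ cf x w
  cf-removeWord-other u [] w ne = refl
  cf-removeWord-other u ((c , v) ∷ x) w ne with v ≟w u
  ... | yes refl with v ≟w w
  ...   | yes refl = ⊥-elim (ne refl)
  ...   | no _ = cf-removeWord-other u x w ne
  cf-removeWord-other u ((c , v) ∷ x) w ne | no _ with v ≟w w
  ...   | yes _ = cong (c ℚ.+_) (cf-removeWord-other u x w ne)
  ...   | no _ = cf-removeWord-other u x w ne

  length-removeWord : ∀ u x → length (removeWord u x) ℕ.≤ length x
  length-removeWord u [] = ℕ.z≤n
  length-removeWord u ((c , v) ∷ x) with v ≟w u
  ... | yes _ = ℕP.m≤n⇒m≤1+n (length-removeWord u x)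
  ... | no _ = ℕ.s≤s (length-removeWord u x)

  length-removeWord-head : ∀ c u x → length (removeWord u ((c , u) ∷ x)) ℕ.< length ((c , u) ∷ x)
  length-removeWord-head c u x with u ≟w u
  ... | yes _ = ℕ.s≤s (length-removeWord u x)
  ... | no ne = ⊥-elim (ne refl)

  Λ-vanishing : ∀ g y → (∀ w → cf y w ≡ 0ℚ) → Λ g y ≡ 0ℚ
  Λ-vanishing g y = go (length y) y ℕP.≤-refl
    where
    go : ∀ k y → length y ℕ.≤ k → (∀ w → cf y w ≡ 0ℚ) → Λ g y ≡ 0ℚ
    go k [] _ _ = refl
    go (suc k) ((d , u) ∷ y) (ℕ.s≤s l) y-vanishes =
      trans (Λ-split g u ((d , u) ∷ y))
       (trans (cong₂ ℚ._+_ (trans (cong (ℚ._* g u) (y-vanishes u)) (ℚP.*-zeroˡ (g u)))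
                           (go k (removeWord u ((d , u) ∷ y)) (ℕP.≤-pred (ℕP.≤-trans (length-removeWord-head d u y) (ℕ.s≤s l))) rest-vanishes))
              (ℚP.+-identityˡ 0ℚ))
      where
      rest-vanishes : ∀ w → cf (removeWord u ((d , u) ∷ y)) w ≡ 0ℚ
      rest-vanishes w with w ≟w u
      ... | yes refl = cf-removeWord-self u ((d , u) ∷ y)
      ... | no w≢u = trans (cf-removeWord-other u ((d , u) ∷ y) w w≢u) (y-vanishes w)

  Λ-⊖ : ∀ g x y → Λ g (x ⊖ y) ≡ Λ g x ℚ.+ ℚ.- 1ℚ ℚ.* Λ g y
  Λ-⊖ g x y = trans (Λ-⊕ g x _) (cong (Λ g x ℚ.+_) (Λ-· g (ℚ.- 1ℚ) y))

  -- A word may occur several times in an element of 𝔸, so this needs the vanishing lemma above.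
  Λ-resp-≃ : ∀ g x y → x ≃ y → Λ g x ≡ Λ g y
  Λ-resp-≃ g x y x≃y = begin
      Λ g x
    ≡⟨ solve 2 (λ a b → a := (a :+ (:- con 1ℚ) :* b) :+ b) refl (Λ g x) (Λ g y) ⟩
      (Λ g x ℚ.+ ℚ.- 1ℚ ℚ.* Λ g y) ℚ.+ Λ g y
    ≡⟨ cong (ℚ._+ Λ g y) (trans (sym (Λ-⊖ g x y)) (Λ-vanishing g (x ⊖ y) x⊖y-vanishes)) ⟩
      0ℚ ℚ.+ Λ g y
    ≡⟨ ℚP.+-identityˡ (Λ g y) ⟩
      Λ g y
    ∎
    where
    open ≡-Reasoning
    x⊖y-vanishes : ∀ w → cf (x ⊖ y) w ≡ 0ℚ
    x⊖y-vanishes w = trans (cf-⊖ x y w) (trans (cong (ℚ._- cf y w) (at x≃y w)) (ℚP.+-inverseʳ (cf y w)))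

  Lin-resp : ∀ f {x y} → x ≃ y → Lin f x ≃ Lin f y
  Lin-resp f {x} {y} e = ⟨ (λ w → trans (cf-Lin f x w) (trans (Λ-resp-≃ _ x y e) (sym (cf-Lin f y w)))) ⟩

  Lin-ext : ∀ {f f'} x → (∀ v → f v ≃ f' v) → Lin f x ≃ Lin f' x
  Lin-ext {f} {f'} x e = ⟨ (λ w → trans (cf-Lin f x w) (trans (Λ-ext x (λ v → at (e v) w)) (sym (cf-Lin f' x w)))) ⟩

  Lin-⊕ : ∀ f x y → Lin f (x ⊕ y) ≃ Lin f x ⊕ Lin f y
  Lin-⊕ f x y = ≡⇒≃ (ListP.concatMap-++ _ x y)

  Lin-· : ∀ f c x → Lin f (c · x) ≃ c · Lin f x
  Lin-· f c x = ⟨ (λ w → trans (cf-Lin f (c · x) w) (trans (Λ-· _ c x) (sym (trans (cf-· c (Lin f x) w) (cong (c ℚ.*_) (cf-Lin f x w)))))) ⟩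

  Lin-word : ∀ f v → Lin f (word v) ≃ f v
  Lin-word f v = ≃-trans (⊕-identityʳ (1ℚ · f v)) (·-identityˡ (f v))

  Lin-comp : ∀ g f x → Lin g (Lin f x) ≃ Lin (λ v → Lin g (f v)) x
  Lin-comp g f [] = ≃-refl
  Lin-comp g f ((c , v) ∷ x) = ≃-trans (Lin-⊕ g (c · f v) (Lin f x)) (⊕-cong (Lin-· g c (f v)) (Lin-comp g f x))

  Lin-fun-⊕ : ∀ f f' x → Lin (λ v → f v ⊕ f' v) x ≃ Lin f x ⊕ Lin f' x
  Lin-fun-⊕ f f' x = ⟨ (λ w → trans (cf-Lin _ x w)
      (trans (Λ-ext x (λ v → trans (cf-⊕ (f v) (f' v) w) (cong (ℚ._+ cf (f' v) w) (sym (ℚP.*-identityˡ (cf (f v) w))))))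
     (trans (Λ-lin (λ v → cf (f v) w) (λ v → cf (f' v) w) 1ℚ x)
       (trans (cong₂ ℚ._+_ (trans (ℚP.*-identityˡ _) (sym (cf-Lin f x w))) (sym (cf-Lin f' x w))) (sym (cf-⊕ (Lin f x) (Lin f' x) w)))))) ⟩

  Lin-fun-· : ∀ c f x → Lin (λ v → c · f v) x ≃ c · Lin f x
  Lin-fun-· c f x = ⟨ (λ w → trans (cf-Lin _ x w) (trans (Λ-ext x (λ v → cf-· c (f v) w))
    (trans (Λ-scale c (λ v → cf (f v) w) x) (sym (trans (cf-· c (Lin f x) w) (cong (c ℚ.*_) (cf-Lin f x w))))))) ⟩

  Lin-fun-𝟘 : ∀ x → Lin (λ _ → 𝟘) x ≃ 𝟘
  Lin-fun-𝟘 x = ⟨ (λ w → trans (cf-Lin _ x w) (Λ-0 x)) ⟩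

  Lin-swap : ∀ (h : Wd → Wd → 𝔸) x y → Lin (λ v → Lin (h v) y) x ≃ Lin (λ u → Lin (λ v → h v u) x) y
  Lin-swap h x y = ⟨ (λ w → trans (cf-Lin _ x w) (trans (Λ-ext x (λ v → cf-Lin (h v) y w))
     (trans (Λ-swap (λ v u → cf (h v u) w) x y) (sym (trans (cf-Lin _ y w) (Λ-ext y (λ u → cf-Lin (λ v → h v u) x w))))))) ⟩

  Lin-word-id : ∀ x → Lin word x ≃ x
  Lin-word-id [] = ≃-refl
  Lin-word-id ((c , v) ∷ x) = ⟨
      (λ w → trans (cf-⊕ (c · word v) (Lin word x) w) (trans (cong₂ ℚ._+_ (cf-· c (word v) w) (at (Lin-word-id x) w)) (cf-cons w))) ⟩
    where
    cf-cons : ∀ w → c ℚ.* cf (word v) w ℚ.+ cf x w ≡ cf ((c , v) ∷ x) w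
    cf-cons w with v ≟w w
    ... | yes _ = cong (ℚ._+ cf x w) (trans (cong (c ℚ.*_) (ℚP.+-identityʳ 1ℚ)) (ℚP.*-identityʳ c))
    ... | no _ = trans (cong (ℚ._+ cf x w) (ℚP.*-zeroʳ c)) (ℚP.+-identityˡ _)

  ⊕-interchange : ∀ a b c d → (a ⊕ b) ⊕ (c ⊕ d) ≃ (a ⊕ c) ⊕ (b ⊕ d)
  ⊕-interchange a b c d = ⟨ (λ w → trans (cf-⊕ (a ⊕ b) (c ⊕ d) w) (trans (cong₂ ℚ._+_ (cf-⊕ a b w) (cf-⊕ c d w))
     (trans (solve 4 (λ a b c d → (a :+ b) :+ (c :+ d) := (a :+ c) :+ (b :+ d)) refl (cf a w) (cf b w) (cf c w) (cf d w))
       (sym (trans (cf-⊕ (a ⊕ c) (b ⊕ d) w) (cong₂ ℚ._+_ (cf-⊕ a c w) (cf-⊕ b d w))))))) ⟩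

  ⊕-right-comm : ∀ a b c → (a ⊕ b) ⊕ c ≃ (a ⊕ c) ⊕ b
  ⊕-right-comm a b c = ⟨ (λ w → trans (cf-⊕ (a ⊕ b) c w) (trans (cong (ℚ._+ cf c w) (cf-⊕ a b w))
     (trans (solve 3 (λ a b c → (a :+ b) :+ c := (a :+ c) :+ b) refl (cf a w) (cf b w) (cf c w))
       (sym (trans (cf-⊕ (a ⊕ c) b w) (cong (ℚ._+ cf b w) (cf-⊕ a c w))))))) ⟩

  ⊕-assoc-comm : ∀ a b c → (a ⊕ c) ⊕ b ≃ a ⊕ (b ⊕ c)
  ⊕-assoc-comm a b c = ⟨ (λ w → trans (cf-⊕ (a ⊕ c) b w) (trans (cong (ℚ._+ cf b w) (cf-⊕ a c w))
     (trans (solve 3 (λ a b c → (a :+ c) :+ b := a :+ (b :+ c)) refl (cf a w) (cf b w) (cf c w))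
       (sym (trans (cf-⊕ a (b ⊕ c) w) (cong (cf a w ℚ.+_) (cf-⊕ b c w))))))) ⟩

  x⊖[x⊖y]≃y : ∀ x y → x ⊖ (x ⊖ y) ≃ y
  x⊖[x⊖y]≃y x y = ⟨ (λ w → trans (cf-⊖ x (x ⊖ y) w) (trans (cong (λ q → cf x w ℚ.- q) (cf-⊖ x y w))
     (solve 2 (λ a b → a :- (a :- b) := b) refl (cf x w) (cf y w)))) ⟩

  [x⊖z]⊖[y⊖z]≃x⊖y : ∀ x y z → (x ⊖ z) ⊖ (y ⊖ z) ≃ x ⊖ y
  [x⊖z]⊖[y⊖z]≃x⊖y x y z = ⟨ (λ w → trans (cf-⊖ (x ⊖ z) (y ⊖ z) w) (trans (cong₂ ℚ._-_ (cf-⊖ x z w) (cf-⊖ y z w))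
     (trans (solve 3 (λ a b c → (a :- c) :- (b :- c) := a :- b) refl (cf x w) (cf y w) (cf z w)) (sym (cf-⊖ x y w))))) ⟩

  [x⊕y]⊖x≃y : ∀ x y → (x ⊕ y) ⊖ x ≃ y
  [x⊕y]⊖x≃y x y = ⟨ (λ w → trans (cf-⊖ (x ⊕ y) x w) (trans (cong (ℚ._- cf x w) (cf-⊕ x y w))
     (solve 2 (λ a b → (a :+ b) :- a := b) refl (cf x w) (cf y w)))) ⟩

  [x⊕y]⊖[x⊕z]≃y⊖z : ∀ x y z → (x ⊕ y) ⊖ (x ⊕ z) ≃ y ⊖ z
  [x⊕y]⊖[x⊕z]≃y⊖z x y z = ⟨ (λ w → trans (cf-⊖ (x ⊕ y) (x ⊕ z) w) (trans (cong₂ ℚ._-_ (cf-⊕ x y w) (cf-⊕ x z w))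
     (trans (solve 3 (λ a b c → (a :+ b) :- (a :+ c) := b :- c) refl (cf x w) (cf y w) (cf z w)) (sym (cf-⊖ y z w))))) ⟩

  ⊕-⊖-interchange : ∀ a b c d → (a ⊖ c) ⊕ (b ⊖ d) ≃ (a ⊕ b) ⊖ (c ⊕ d)
  ⊕-⊖-interchange a b c d = ⟨ (λ w → trans (cf-⊕ (a ⊖ c) (b ⊖ d) w) (trans (cong₂ ℚ._+_ (cf-⊖ a c w) (cf-⊖ b d w))
     (trans (solve 4 (λ a b c d → (a :- c) :+ (b :- d) := (a :+ b) :- (c :+ d)) refl (cf a w) (cf b w) (cf c w) (cf d w))
       (sym (trans (cf-⊖ (a ⊕ b) (c ⊕ d) w) (cong₂ ℚ._-_ (cf-⊕ a b w) (cf-⊕ c d w))))))) ⟩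

  x⊖y≃𝟘⇒x≃y : ∀ {x y} → x ⊖ y ≃ 𝟘 → x ≃ y
  x⊖y≃𝟘⇒x≃y {x} {y} x⊖y≃𝟘 = ⟨ (λ w → trans (solve 2 (λ a b → a := (a :- b) :+ b) refl (cf x w) (cf y w))
     (trans (cong (ℚ._+ cf y w) (trans (sym (cf-⊖ x y w)) (at x⊖y≃𝟘 w))) (ℚP.+-identityˡ (cf y w)))) ⟩

  record IsLinear (F : 𝔸 → 𝔸) : Set where
    field
      resp-≃ : ∀ {x y} → x ≃ y → F x ≃ F y
      map-⊕ : ∀ x y → F (x ⊕ y) ≃ F x ⊕ F y
      map-· : ∀ c x → F (c · x) ≃ c · F x
      map-𝟘 : F 𝟘 ≃ 𝟘
  open IsLinear public

  Lin-natural : ∀ {F} → IsLinear F → ∀ g x → F (Lin g x) ≃ Lin (λ u → F (g u)) x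
  Lin-natural L g [] = map-𝟘 L
  Lin-natural L g ((c , v) ∷ x) = ≃-trans (map-⊕ L (c · g v) (Lin g x)) (⊕-cong (map-· L c (g v)) (Lin-natural L g x))

  Lin-expansion : ∀ {F} → IsLinear F → ∀ x → F x ≃ Lin (λ u → F (word u)) x
  Lin-expansion L x = ≃-trans (resp-≃ L (≃-sym (Lin-word-id x))) (Lin-natural L word x)

  Lin-linear : ∀ f → IsLinear (Lin f)
  Lin-linear f = record { resp-≃ = Lin-resp f ; map-⊕ = Lin-⊕ f ; map-· = Lin-· f ; map-𝟘 = ≃-refl }

  ·-linear : ∀ c → IsLinear (c ·_)
  ·-linear c = record
    { resp-≃ = ·-cong c ; map-⊕ = ·-distribˡ-⊕ c ; map-𝟘 = ≃-refl
    ; map-· = λ d x → ≃-trans (·-assoc c d x) (≃-trans (·-congˡ x (ℚP.*-comm c d)) (≃-sym (·-assoc d c x))) }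

  ΣL : ℕ → (ℕ → 𝔸) → 𝔸
  ΣL zero f = 𝟘
  ΣL (suc n) f = f 0 ⊕ ΣL n (λ k → f (suc k))

  sumA-applyUpTo : ∀ n f → sumA N (applyUpTo f n) ≡ ΣL n f
  sumA-applyUpTo zero f = refl
  sumA-applyUpTo (suc n) f = cong (f 0 ⊕_) (sumA-applyUpTo n (λ k → f (suc k)))

  sumA-ΣL : ∀ n f → sumA N (map f (upTo n)) ≃ ΣL n f
  sumA-ΣL n f = ≡⇒≃ (trans (cong (sumA N) (ListP.map-upTo f n)) (sumA-applyUpTo n f))

  ΣL-cong : ∀ n {f g} → (∀ i → f i ≃ g i) → ΣL n f ≃ ΣL n g
  ΣL-cong zero e = ≃-refl
  ΣL-cong (suc n) e = ⊕-cong (e 0) (ΣL-cong n (λ i → e (suc i)))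

  ΣL-⊕ : ∀ n f g → ΣL n (λ i → f i ⊕ g i) ≃ ΣL n f ⊕ ΣL n g
  ΣL-⊕ zero f g = ≃-refl
  ΣL-⊕ (suc n) f g = ≃-trans (⊕-cong (≃-refl {f 0 ⊕ g 0}) (ΣL-⊕ n (λ i → f (suc i)) (λ i → g (suc i)))) (⊕-interchange (f 0) (g 0) _ _)

  ΣL-linear : ∀ {L} → IsLinear L → ∀ n f → L (ΣL n f) ≃ ΣL n (λ i → L (f i))
  ΣL-linear Lr zero f = map-𝟘 Lr
  ΣL-linear {L} Lr (suc n) f = ≃-trans (map-⊕ Lr (f 0) _) (⊕-cong (≃-refl {L (f 0)}) (ΣL-linear Lr n (λ i → f (suc i))))

  ΣL-last : ∀ n f → ΣL (suc n) f ≃ ΣL n f ⊕ f n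
  ΣL-last zero f = ≃-trans (⊕-identityʳ (f 0)) (≃-sym (⊕-identityˡ (f 0)))
  ΣL-last (suc n) f = ≃-trans (⊕-cong (≃-refl {f 0}) (ΣL-last n (λ k → f (suc k)))) (≃-sym (⊕-assoc (f 0) _ _))

  ΣL-split : ∀ n k f → k ≤ n → ΣL n f ≃ ΣL k f ⊕ ΣL (n ∸ k) (λ j → f (k + j))
  ΣL-split n zero f le = ≃-refl
  ΣL-split (suc n) (suc k) f (s≤s le) = ≃-trans (⊕-cong (≃-refl {f 0}) (ΣL-split n k (λ i → f (suc i)) le)) (≃-sym (⊕-assoc (f 0) _ _))

module Products (N : ℕ) {{nz : NonZero N}} where
  open FreeModule N public

  concatMap-cong : ∀ (f g : ℚ × Wd → 𝔸) x → (∀ e → f e ≃ g e) → concatMap f x ≃ concatMap g x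
  concatMap-cong f g [] e = ≃-refl
  concatMap-cong f g (a ∷ x) e = ⊕-cong (e a) (concatMap-cong f g x e)

  cons-cong : ∀ {c c'} v {x x'} → c ≡ c' → x ≃ x' → ((c , v) ∷ x) ≃ ((c' , v) ∷ x')
  cons-cong v refl p = ⊕-cong {(_ , v) ∷ []} ≃-refl p

  Bil : (Wd → Wd → 𝔸) → 𝔸 → 𝔸 → 𝔸
  Bil h x y = Lin (λ v → Lin (h v) y) x

  Bil-congˡ : ∀ h {x x'} y → x ≃ x' → Bil h x y ≃ Bil h x' y
  Bil-congˡ h y p = Lin-resp (λ v → Lin (h v) y) p

  Bil-congʳ : ∀ h x {y y'} → y ≃ y' → Bil h x y ≃ Bil h x y'
  Bil-congʳ h x p = Lin-ext x (λ v → Lin-resp (h v) p)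

  Bil-cong : ∀ h {x x' y y'} → x ≃ x' → y ≃ y' → Bil h x y ≃ Bil h x' y'
  Bil-cong h {x} {x'} {y} p q = ≃-trans (Bil-congˡ h y p) (Bil-congʳ h x' q)

  Bil-⊕ˡ : ∀ h x x' y → Bil h (x ⊕ x') y ≃ Bil h x y ⊕ Bil h x' y
  Bil-⊕ˡ h x x' y = Lin-⊕ (λ v → Lin (h v) y) x x'

  Bil-⊕ʳ : ∀ h x y y' → Bil h x (y ⊕ y') ≃ Bil h x y ⊕ Bil h x y'
  Bil-⊕ʳ h x y y' = ≃-trans (Lin-ext x (λ v → Lin-⊕ (h v) y y')) (Lin-fun-⊕ (λ v → Lin (h v) y) (λ v → Lin (h v) y') x)

  Bil-·ˡ : ∀ h c x y → Bil h (c · x) y ≃ c · Bil h x y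
  Bil-·ˡ h c x y = Lin-· (λ v → Lin (h v) y) c x

  Bil-·ʳ : ∀ h c x y → Bil h x (c · y) ≃ c · Bil h x y
  Bil-·ʳ h c x y = ≃-trans (Lin-ext x (λ v → Lin-· (h v) c y)) (Lin-fun-· c (λ v → Lin (h v) y) x)

  Bil-⊖ˡ : ∀ h x x' y → Bil h (x ⊖ x') y ≃ Bil h x y ⊖ Bil h x' y
  Bil-⊖ˡ h x x' y = ≃-trans (Bil-⊕ˡ h x _ y) (⊕-cong (≃-refl {Bil h x y}) (Bil-·ˡ h (ℚ.- 1ℚ) x' y))

  Bil-⊖ʳ : ∀ h x y y' → Bil h x (y ⊖ y') ≃ Bil h x y ⊖ Bil h x y'
  Bil-⊖ʳ h x y y' = ≃-trans (Bil-⊕ʳ h x y _) (⊕-cong (≃-refl {Bil h x y}) (Bil-·ʳ h (ℚ.- 1ℚ) x y'))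

  Bil-𝟘ʳ : ∀ h x → Bil h x 𝟘 ≃ 𝟘
  Bil-𝟘ʳ h x = Lin-fun-𝟘 x

  Bil-fun-⊕ : ∀ f g x y → Bil (λ v u → f v u ⊕ g v u) x y ≃ Bil f x y ⊕ Bil g x y
  Bil-fun-⊕ f g x y = ≃-trans (Lin-ext x (λ v → Lin-fun-⊕ (f v) (g v) y)) (Lin-fun-⊕ (λ v → Lin (f v) y) (λ v → Lin (g v) y) x)

  module BilinearLaws (_∙_ : 𝔸 → 𝔸 → 𝔸) (h : Wd → Wd → 𝔸) (∙≃Bil : ∀ x y → x ∙ y ≃ Bil h x y) where

    via-Bil : ∀ {x y x' y'} → Bil h x y ≃ Bil h x' y' → x ∙ y ≃ x' ∙ y'
    via-Bil {x} {y} {x'} {y'} e = ≃-trans (∙≃Bil x y) (≃-trans e (≃-sym (∙≃Bil x' y')))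

    ∙-cong : ∀ {x x' y y'} → x ≃ x' → y ≃ y' → x ∙ y ≃ x' ∙ y'
    ∙-cong p q = via-Bil (Bil-cong h p q)

    ∙-⊕ˡ : ∀ x x' y → (x ⊕ x') ∙ y ≃ x ∙ y ⊕ x' ∙ y
    ∙-⊕ˡ x x' y = ≃-trans (∙≃Bil (x ⊕ x') y) (≃-trans (Bil-⊕ˡ h x x' y) (≃-sym (⊕-cong (∙≃Bil x y) (∙≃Bil x' y))))

    ∙-⊕ʳ : ∀ x y y' → x ∙ (y ⊕ y') ≃ x ∙ y ⊕ x ∙ y'
    ∙-⊕ʳ x y y' = ≃-trans (∙≃Bil x (y ⊕ y')) (≃-trans (Bil-⊕ʳ h x y y') (≃-sym (⊕-cong (∙≃Bil x y) (∙≃Bil x y'))))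

    ∙-·ˡ : ∀ c x y → (c · x) ∙ y ≃ c · (x ∙ y)
    ∙-·ˡ c x y = ≃-trans (∙≃Bil (c · x) y) (≃-trans (Bil-·ˡ h c x y) (·-cong c (≃-sym (∙≃Bil x y))))

    ∙-·ʳ : ∀ c x y → x ∙ (c · y) ≃ c · (x ∙ y)
    ∙-·ʳ c x y = ≃-trans (∙≃Bil x (c · y)) (≃-trans (Bil-·ʳ h c x y) (·-cong c (≃-sym (∙≃Bil x y))))

    ∙-⊖ˡ : ∀ x x' y → (x ⊖ x') ∙ y ≃ x ∙ y ⊖ x' ∙ y
    ∙-⊖ˡ x x' y = ≃-trans (∙≃Bil (x ⊖ x') y) (≃-trans (Bil-⊖ˡ h x x' y) (≃-sym (⊖-cong (∙≃Bil x y) (∙≃Bil x' y))))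

    ∙-⊖ʳ : ∀ x y y' → x ∙ (y ⊖ y') ≃ x ∙ y ⊖ x ∙ y'
    ∙-⊖ʳ x y y' = ≃-trans (∙≃Bil x (y ⊖ y')) (≃-trans (Bil-⊖ʳ h x y y') (≃-sym (⊖-cong (∙≃Bil x y) (∙≃Bil x y'))))

    ∙-𝟘ˡ : ∀ y → 𝟘 ∙ y ≃ 𝟘
    ∙-𝟘ˡ y = ∙≃Bil 𝟘 y

    ∙-𝟘ʳ : ∀ x → x ∙ 𝟘 ≃ 𝟘
    ∙-𝟘ʳ x = ≃-trans (∙≃Bil x 𝟘) (Bil-𝟘ʳ h x)

    ∙-linearˡ : ∀ y → IsLinear (_∙ y)
    ∙-linearˡ y = record { resp-≃ = λ p → ∙-cong p ≃-refl ; map-⊕ = λ x x' → ∙-⊕ˡ x x' y ; map-· = λ c x → ∙-·ˡ c x y ; map-𝟘 = ∙-𝟘ˡ y }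

    ∙-linearʳ : ∀ x → IsLinear (x ∙_)
    ∙-linearʳ x = record { resp-≃ = ∙-cong ≃-refl ; map-⊕ = ∙-⊕ʳ x ; map-· = λ c y → ∙-·ʳ c x y ; map-𝟘 = ∙-𝟘ʳ x }

  _⊙_ : 𝔸 → 𝔸 → 𝔸
  x ⊙ y = _⊗_ N x y
  infixr 8 _⊙_

  concatWords : Wd → Wd → 𝔸
  concatWords v u = word (v ++ u)

  ⊙-Bil : ∀ x y → x ⊙ y ≃ Bil concatWords x y
  ⊙-Bil x y = concatMap-cong _ _ x (λ { (c , w) → prefix-scaled c w y })
    where
    prefix-scaled : ∀ c w y → map (λ { (d , v) → (c ℚ.* d , w ++ v) }) y ≃ c · Lin (λ u → word (w ++ u)) y
    prefix-scaled c w [] = ≃-refl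
    prefix-scaled c w ((d , u) ∷ y) = cons-cong (w ++ u) (cong (c ℚ.*_) (sym (ℚP.*-identityʳ d))) (prefix-scaled c w y)

  open BilinearLaws _⊙_ concatWords ⊙-Bil public using () renaming
    ( ∙-cong to ⊙-cong ; ∙-⊕ˡ to ⊙-⊕ˡ ; ∙-⊕ʳ to ⊙-⊕ʳ ; ∙-·ˡ to ⊙-·ˡ ; ∙-·ʳ to ⊙-·ʳ
    ; ∙-⊖ʳ to ⊙-⊖ʳ ; ∙-𝟘ʳ to ⊙-𝟘ʳ ; ∙-linearˡ to ⊙-linearˡ ; ∙-linearʳ to ⊙-linearʳ )

  word-⊙ : ∀ v y → word v ⊙ y ≃ Lin (λ u → word (v ++ u)) y
  word-⊙ v y = ≃-trans (⊙-Bil (word v) y) (Lin-word (λ w → Lin (λ u → word (w ++ u)) y) v)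

  ⊙-assoc : ∀ x y z → (x ⊙ y) ⊙ z ≃ x ⊙ (y ⊙ z)
  ⊙-assoc x y z = begin
      (x ⊙ y) ⊙ z
    ≈⟨ ≃-trans (⊙-Bil (x ⊙ y) z) (Bil-congˡ concatWords z (⊙-Bil x y)) ⟩
      Lin F (Lin (λ v → Lin (λ u → word (v ++ u)) y) x)
    ≈⟨ Lin-comp F (λ v → Lin (λ u → word (v ++ u)) y) x ⟩
      Lin (λ v → Lin F (Lin (λ u → word (v ++ u)) y)) x
    ≈⟨ Lin-ext x (λ v → ≃-trans (Lin-comp F (λ u → word (v ++ u)) y) (Lin-ext y (λ u → Lin-word F (v ++ u)))) ⟩
      Lin (λ v → Lin (λ u → Lin (λ r → word ((v ++ u) ++ r)) z) y) x
    ≈⟨ Lin-ext x (λ v → Lin-ext y (λ u → Lin-ext z (λ r → ≡⇒≃ (cong word (ListP.++-assoc v u r))))) ⟩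
      Lin (λ v → Lin (λ u → Lin (λ r → word (v ++ (u ++ r))) z) y) x
    ≈⟨ Lin-ext x (λ v → ≃-sym (prefix-⊙ v)) ⟩
      Lin (λ v → Lin (λ t → word (v ++ t)) (Lin (λ u → Lin (λ r → word (u ++ r)) z) y)) x
    ≈⟨ ≃-sym (≃-trans (⊙-Bil x (y ⊙ z)) (Bil-congʳ concatWords x (⊙-Bil y z))) ⟩
      x ⊙ (y ⊙ z)
    ∎
    where
    open SR ≃-setoid
    F : Wd → 𝔸
    F t = Lin (λ r → word (t ++ r)) z
    prefix-⊙ : ∀ v → Lin (λ t → word (v ++ t)) (Lin (λ u → Lin (λ r → word (u ++ r)) z) y)
                   ≃ Lin (λ u → Lin (λ r → word (v ++ (u ++ r))) z) y
    prefix-⊙ v = ≃-trans (Lin-comp (λ t → word (v ++ t)) (λ u → Lin (λ r → word (u ++ r)) z) y)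
                         (Lin-ext y (λ u → Lin-comp (λ t → word (v ++ t)) (λ r → word (u ++ r)) z))

  ⊙-𝟙ˡ : ∀ x → 𝟙 ⊙ x ≃ x
  ⊙-𝟙ˡ x = ≃-trans (word-⊙ [] x) (Lin-word-id x)

  ⊙-𝟙ʳ : ∀ x → x ⊙ 𝟙 ≃ x
  ⊙-𝟙ʳ x = ≃-trans (⊙-Bil x 𝟙) (≃-trans (Lin-ext x append-[]) (Lin-word-id x))
    where
    append-[] : ∀ v → Lin (concatWords v) 𝟙 ≃ word v
    append-[] v = ≃-trans (Lin-word (concatWords v) []) (≡⇒≃ (cong word (ListP.++-identityʳ v)))

  _✶_ : 𝔸 → 𝔸 → 𝔸
  x ✶ y = _*_ N x y
  infixr 8 _✶_

  stuffleWords : Wd → Wd → 𝔸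
  stuffleWords = stW N

  ✶-Bil : ∀ x y → x ✶ y ≃ Bil stuffleWords x y
  ✶-Bil x y = concatMap-cong _ _ x (λ { (c , v) → scaled c v y })
    where
    scaled : ∀ c v y → concatMap (λ { (d , w) → (c ℚ.* d) · stuffleWords v w }) y ≃ c · Lin (stuffleWords v) y
    scaled c v [] = ≃-refl
    scaled c v ((d , w) ∷ y) =
      ≃-trans (⊕-cong (≃-sym (·-assoc c d (stuffleWords v w))) (scaled c v y))
              (≃-sym (·-distribˡ-⊕ c (d · stuffleWords v w) (Lin (stuffleWords v) y)))

  open BilinearLaws _✶_ stuffleWords ✶-Bil public using () renaming
    ( ∙-cong to ✶-cong ; ∙-·ʳ to ✶-·ʳ ; ∙-linearʳ to ✶-linearʳ )

  stuffleWords-[]ʳ : ∀ v → stuffleWords v [] ≡ word v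
  stuffleWords-[]ʳ [] = refl
  stuffleWords-[]ʳ (l ∷ v) = refl

  ✶-𝟙ʳ : ∀ x → x ✶ 𝟙 ≃ x
  ✶-𝟙ʳ x = ≃-trans (✶-Bil x 𝟙) (≃-trans (Lin-ext x (λ v → ≃-trans (Lin-word (stuffleWords v) []) (≡⇒≃ (stuffleWords-[]ʳ v)))) (Lin-word-id x))

module Merge (N : ℕ) {{nz : NonZero N}} where
  open Products N public
  open +-*-Solver

  i₀ : Fin N
  i₀ = zero' N

  toℕ-i₀ : toℕ i₀ ≡ 0
  toℕ-i₀ = trans (FinP.toℕ-fromℕ< _) (m<n⇒m%n≡m (ℕ.>-nonZero⁻¹ N))

  -- y₀ s is the letter y_{s+1,0} (Defs stores the exponent s - 1).
  y₀ : ℕ → Letter N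
  y₀ s = (s , i₀)

  +F-i₀ : ∀ i → _+F_ N i i₀ ≡ i
  +F-i₀ i = FinP.toℕ-injective
      (trans (FinP.toℕ-fromℕ< _)
      (trans (cong (λ k → (toℕ i + k) % N) toℕ-i₀) (trans (cong (_% N) (ℕP.+-identityʳ (toℕ i))) (m<n⇒m%n≡m (FinP.toℕ<n i)))))

  negF-i₀ : negF N i₀ ≡ i₀
  negF-i₀ = FinP.toℕ-injective (trans (FinP.toℕ-fromℕ< _) (trans (cong (λ k → (N ℕ.∸ k) % N) toℕ-i₀) (trans (n%n≡0 N) (sym toℕ-i₀))))

  τ-i₀ : ∀ u → τ N i₀ u ≡ u
  τ-i₀ [] = refl
  τ-i₀ ((s , i) ∷ u) = cong₂ _∷_ (cong (s ,_) (+F-i₀ i)) (τ-i₀ u)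

  τA-i₀ : ∀ x → τA N i₀ x ≡ x
  τA-i₀ [] = refl
  τA-i₀ ((c , u) ∷ x) = cong₂ _∷_ (cong (c ,_) (τ-i₀ u)) (τA-i₀ x)

  -- Only used on letters y_{s,0}: the stored exponents s - 1 and t - 1 merge to (s - 1) + (t - 1) + 1.
  mergeWords : Wd → Wd → 𝔸
  mergeWords ((s , i) ∷ []) ((t , j) ∷ []) = word (y₀ (suc (s + t)) ∷ [])
  mergeWords _ _ = 𝟘

  -- At index 0 the shifts τ in the stuffle recursion are the identity.
  stuffleWords-letters : ∀ s t w → stuffleWords (y₀ s ∷ []) (y₀ t ∷ w) ≡ (word (y₀ s ∷ []) ⊙ word (y₀ t ∷ w)) ⊕
      ((word (y₀ t ∷ []) ⊙ stuffleWords (y₀ s ∷ []) w) ⊕ (mergeWords (y₀ s ∷ []) (y₀ t ∷ []) ⊙ word w))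
  stuffleWords-letters s t w rewrite negF-i₀ | +F-i₀ i₀ | τ-i₀ w | τA-i₀ (stuffleWords (y₀ s ∷ []) w) | τ-i₀ w = refl

  IsZetaLetter : Wd → Set
  IsZetaLetter v = ∃ λ s → v ≡ y₀ s ∷ []

  AllZetaLetters : 𝔸 → Set
  AllZetaLetters x = All (λ e → IsZetaLetter (proj₂ e)) x

  In𝔷 : 𝔸 → Set
  In𝔷 x = Σ 𝔸 λ x' → (x ≃ x') × AllZetaLetters x'

  AllZetaLetters-⊕ : ∀ {x y} → AllZetaLetters x → AllZetaLetters y → AllZetaLetters (x ⊕ y)
  AllZetaLetters-⊕ [] q = q
  AllZetaLetters-⊕ (p ∷ ps) q = p ∷ AllZetaLetters-⊕ ps q

  AllZetaLetters-· : ∀ c {x} → AllZetaLetters x → AllZetaLetters (c · x)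
  AllZetaLetters-· c [] = []
  AllZetaLetters-· c (p ∷ ps) = p ∷ AllZetaLetters-· c ps

  AllZetaLetters-Lin : ∀ f x → (∀ v → AllZetaLetters (f v)) → AllZetaLetters (Lin f x)
  AllZetaLetters-Lin f [] h = []
  AllZetaLetters-Lin f ((c , v) ∷ x) h = AllZetaLetters-⊕ (AllZetaLetters-· c (h v)) (AllZetaLetters-Lin f x h)

  AllZetaLetters-map : ∀ {B : Set} (g : B → ℚ × Wd) l → (∀ p → IsZetaLetter (proj₂ (g p))) → AllZetaLetters (map g l)
  AllZetaLetters-map g [] h = []
  AllZetaLetters-map g (p ∷ l) h = h p ∷ AllZetaLetters-map g l h

  Lin-ext-AllZetaLetters : ∀ {f f'} x → AllZetaLetters x → (∀ s → f (y₀ s ∷ []) ≃ f' (y₀ s ∷ [])) → Lin f x ≃ Lin f' x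
  Lin-ext-AllZetaLetters [] [] e = ≃-refl
  Lin-ext-AllZetaLetters ((c , .(y₀ s ∷ [])) ∷ x) ((s , refl) ∷ ps) e = ⊕-cong (·-cong c (e s)) (Lin-ext-AllZetaLetters x ps e)

  Lin-ext-𝔷 : ∀ {f f'} {x} → In𝔷 x → (∀ s → f (y₀ s ∷ []) ≃ f' (y₀ s ∷ [])) → Lin f x ≃ Lin f' x
  Lin-ext-𝔷 {f} {f'} (x' , p , a) e = ≃-trans (Lin-resp f p) (≃-trans (Lin-ext-AllZetaLetters x' a e) (Lin-resp f' (≃-sym p)))

  In𝔷-resp : ∀ {x y} → x ≃ y → In𝔷 y → In𝔷 x
  In𝔷-resp p (y' , q , a) = y' , ≃-trans p q , a

  In𝔷-⊕ : ∀ {x y} → In𝔷 x → In𝔷 y → In𝔷 (x ⊕ y)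
  In𝔷-⊕ (x' , p , a) (y' , q , b) = x' ⊕ y' , ⊕-cong p q , AllZetaLetters-⊕ a b

  In𝔷-· : ∀ c {x} → In𝔷 x → In𝔷 (c · x)
  In𝔷-· c (x' , p , a) = c · x' , ·-cong c p , AllZetaLetters-· c a

  In𝔷-𝟘 : In𝔷 𝟘
  In𝔷-𝟘 = 𝟘 , ≃-refl , []

  ∈𝔷⇒In𝔷 : ∀ {z} → _∈𝔷 N z → In𝔷 z
  ∈𝔷⇒In𝔷 (cs , p) = zetaElt N cs , ⟨ p ⟩ , AllZetaLetters-map _ _ (λ { (s , c) → s , refl })

  _⋄_ : 𝔸 → 𝔸 → 𝔸
  x ⋄ y = Bil mergeWords x y
  infixr 8 _⋄_

  open BilinearLaws _⋄_ mergeWords (λ _ _ → ≃-refl) public using () renaming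
    ( ∙-cong to ⋄-cong ; ∙-⊕ˡ to ⋄-⊕ˡ ; ∙-⊕ʳ to ⋄-⊕ʳ ; ∙-·ˡ to ⋄-·ˡ ; ∙-·ʳ to ⋄-·ʳ
    ; ∙-⊖ˡ to ⋄-⊖ˡ ; ∙-⊖ʳ to ⋄-⊖ʳ ; ∙-linearˡ to ⋄-linearˡ ; ∙-linearʳ to ⋄-linearʳ )

  AllZetaLetters-mergeWords : ∀ v u → AllZetaLetters (mergeWords v u)
  AllZetaLetters-mergeWords [] u = []
  AllZetaLetters-mergeWords ((s , i) ∷ []) [] = []
  AllZetaLetters-mergeWords ((s , i) ∷ []) ((t , j) ∷ []) = (suc (s + t) , refl) ∷ []
  AllZetaLetters-mergeWords ((s , i) ∷ []) ((t , j) ∷ _ ∷ _) = []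
  AllZetaLetters-mergeWords ((s , i) ∷ _ ∷ _) u = []

  In𝔷-⋄ : ∀ x y → In𝔷 (x ⋄ y)
  In𝔷-⋄ x y = x ⋄ y , ≃-refl , AllZetaLetters-Lin _ x (λ v → AllZetaLetters-Lin (mergeWords v) y (λ u → AllZetaLetters-mergeWords v u))

  stuffle-letter-⊙ : ∀ s t w → let v = y₀ s ∷ [] ; v' = y₀ t ∷ [] in
    Lin (stuffleWords v) (word v' ⊙ w) ≃ word v ⊙ (word v' ⊙ w) ⊕ (word v' ⊙ Lin (stuffleWords v) w ⊕ mergeWords v v' ⊙ w)
  stuffle-letter-⊙ s t w = begin
      Lin (stuffleWords v) (word v' ⊙ w)
    ≈⟨ ≃-trans (Lin-resp (stuffleWords v) (word-⊙ v' w))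
        (≃-trans (Lin-comp (stuffleWords v) (λ u → word (v' ++ u)) w) (Lin-ext w (λ u → Lin-word (stuffleWords v) (v' ++ u)))) ⟩
      Lin (λ u → stuffleWords v (v' ++ u)) w
    ≈⟨ Lin-ext w (λ u → ≡⇒≃ (stuffleWords-letters s t u)) ⟩
      Lin (λ u → word v ⊙ word (v' ++ u) ⊕ (word v' ⊙ stuffleWords v u ⊕ mergeWords v v' ⊙ word u)) w
    ≈⟨ ≃-trans (Lin-fun-⊕ (λ u → word v ⊙ word (v' ++ u)) _ w)
               (⊕-cong (≃-refl {Lin (λ u → word v ⊙ word (v' ++ u)) w})
                   (Lin-fun-⊕ (λ u → word v' ⊙ stuffleWords v u) (λ u → mergeWords v v' ⊙ word u) w)) ⟩
      Lin (λ u → word v ⊙ word (v' ++ u)) w ⊕ (Lin (λ u → word v' ⊙ stuffleWords v u) w ⊕ Lin (λ u → mergeWords v v' ⊙ word u) w)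
    ≈⟨ ⊕-cong (≃-trans (≃-sym (Lin-natural (⊙-linearʳ (word v)) (λ u → word (v' ++ u)) w)) (⊙-cong (≃-refl {word v}) (≃-sym (word-⊙ v' w))))
         (⊕-cong (≃-sym (Lin-natural (⊙-linearʳ (word v')) (stuffleWords v) w)) (≃-sym (Lin-expansion (⊙-linearʳ (mergeWords v v')) w))) ⟩
      word v ⊙ (word v' ⊙ w) ⊕ (word v' ⊙ Lin (stuffleWords v) w ⊕ mergeWords v v' ⊙ w)
    ∎
    where
    open SR ≃-setoid
    v v' : Wd
    v = y₀ s ∷ []
    v' = y₀ t ∷ []

  ✶-⊙-expansion : ∀ {c y} → In𝔷 c → In𝔷 y → ∀ w → c ✶ (y ⊙ w) ≃ (c ⊙ y) ⊙ w ⊕ (y ⊙ (c ✶ w) ⊕ (c ⋄ y) ⊙ w)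
  ✶-⊙-expansion {c} {y} c∈𝔷 y∈𝔷 w = begin
      c ✶ (y ⊙ w)
    ≈⟨ ≃-trans (✶-Bil c (y ⊙ w))
        (Lin-ext c (λ v → ≃-trans (Lin-resp (stuffleWords v) (Lin-expansion (⊙-linearˡ w) y)) (Lin-comp (stuffleWords v) (λ v' → word v' ⊙ w) y))) ⟩
      Bil (λ v v' → Lin (stuffleWords v) (word v' ⊙ w)) c y
    ≈⟨ Lin-ext-𝔷 c∈𝔷 (λ s → Lin-ext-𝔷 y∈𝔷 (λ t → stuffle-letter-⊙ s t w)) ⟩
      Bil (λ v v' → word v ⊙ (word v' ⊙ w) ⊕ (word v' ⊙ Lin (stuffleWords v) w ⊕ mergeWords v v' ⊙ w)) c y
    ≈⟨ ≃-trans (Bil-fun-⊕ _ _ c y) (⊕-cong (≃-refl {Bil (λ v v' → word v ⊙ (word v' ⊙ w)) c y}) (Bil-fun-⊕ _ _ c y)) ⟩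
      Bil (λ v v' → word v ⊙ (word v' ⊙ w)) c y ⊕ (Bil (λ v v' → word v' ⊙ Lin (stuffleWords v) w) c y ⊕ Bil (λ v v' → mergeWords v v' ⊙ w) c y)
    ≈⟨ ⊕-cong concatenated (⊕-cong stuffled merged) ⟩
      (c ⊙ y) ⊙ w ⊕ (y ⊙ (c ✶ w) ⊕ (c ⋄ y) ⊙ w)
    ∎
    where
    open SR ≃-setoid
    concatenated : Bil (λ v v' → word v ⊙ (word v' ⊙ w)) c y ≃ (c ⊙ y) ⊙ w
    concatenated = ≃-sym (≃-trans (⊙-assoc c y w) (≃-trans (Lin-expansion (⊙-linearˡ (y ⊙ w)) c)
      (Lin-ext c (λ v → ≃-trans (⊙-cong (≃-refl {word v}) (Lin-expansion (⊙-linearˡ w) y))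
          (Lin-natural (⊙-linearʳ (word v)) (λ v' → word v' ⊙ w) y)))))
    stuffled : Bil (λ v v' → word v' ⊙ Lin (stuffleWords v) w) c y ≃ y ⊙ (c ✶ w)
    stuffled = ≃-sym (≃-trans (Lin-expansion (⊙-linearˡ (c ✶ w)) y)
      (≃-trans (Lin-ext y (λ v' → ≃-trans (⊙-cong (≃-refl {word v'}) (✶-Bil c w))
          (Lin-natural (⊙-linearʳ (word v')) (λ v → Lin (stuffleWords v) w) c)))
               (Lin-swap (λ v' v → word v' ⊙ Lin (stuffleWords v) w) y c)))
    merged : Bil (λ v v' → mergeWords v v' ⊙ w) c y ≃ (c ⋄ y) ⊙ w
    merged = ≃-sym (≃-trans (Lin-natural (⊙-linearˡ w) (λ v → Lin (mergeWords v) y) c) (Lin-ext c (λ v → Lin-natural (⊙-linearˡ w) (mergeWords v) y)))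

  _⊚_ : 𝔸 → 𝔸 → 𝔸
  x ⊚ y = _∘_ N x y

  ⊚-cong : ∀ {x x' y y'} → x ≃ x' → y ≃ y' → x ⊚ y ≃ x' ⊚ y'
  ⊚-cong {x} {x'} {y} {y'} p q = ⊖-cong {(x ✶ y) ⊖ (x ⊙ y)} {(x' ✶ y') ⊖ (x' ⊙ y')} (⊖-cong {x ✶ y} {x' ✶ y'} (✶-cong p q) (⊙-cong p q)) (⊙-cong q p)

  ✶-𝔷 : ∀ {c y} → In𝔷 c → In𝔷 y → c ✶ y ≃ c ⊙ y ⊕ (y ⊙ c ⊕ c ⋄ y)
  ✶-𝔷 {c} {y} c∈𝔷 y∈𝔷 = ≃-trans (✶-cong {c} {c} ≃-refl (≃-sym (⊙-𝟙ʳ y))) (≃-trans (✶-⊙-expansion c∈𝔷 y∈𝔷 𝟙)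
     (⊕-cong (⊙-𝟙ʳ (c ⊙ y)) (⊕-cong (⊙-cong {y} {y} ≃-refl (✶-𝟙ʳ c)) (⊙-𝟙ʳ (c ⋄ y)))))

  ⊚-𝔷 : ∀ {c y} → In𝔷 c → In𝔷 y → c ⊚ y ≃ c ⋄ y
  ⊚-𝔷 {c} {y} c∈𝔷 y∈𝔷 = ⟨ (λ w → begin
      cf (c ⊚ y) w
    ≡⟨ trans (cf-⊖ ((c ✶ y) ⊖ (c ⊙ y)) (y ⊙ c) w) (cong (ℚ._- cf (y ⊙ c) w) (cf-⊖ (c ✶ y) (c ⊙ y) w)) ⟩
      cf (c ✶ y) w ℚ.- cf (c ⊙ y) w ℚ.- cf (y ⊙ c) w
    ≡⟨ cong (λ q → q ℚ.- cf (c ⊙ y) w ℚ.- cf (y ⊙ c) w) (stuffle-coefficient w) ⟩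
      (cf (c ⊙ y) w ℚ.+ (cf (y ⊙ c) w ℚ.+ cf (c ⋄ y) w)) ℚ.- cf (c ⊙ y) w ℚ.- cf (y ⊙ c) w
    ≡⟨ solve 3 (λ a b m → a :+ (b :+ m) :- a :- b := m) refl (cf (c ⊙ y) w) (cf (y ⊙ c) w) (cf (c ⋄ y) w) ⟩
      cf (c ⋄ y) w
    ∎) ⟩
    where
    open ≡-Reasoning
    stuffle-coefficient : ∀ w → cf (c ✶ y) w ≡ cf (c ⊙ y) w ℚ.+ (cf (y ⊙ c) w ℚ.+ cf (c ⋄ y) w)
    stuffle-coefficient w = trans (at (✶-𝔷 c∈𝔷 y∈𝔷) w) (trans (cf-⊕ (c ⊙ y) _ w) (cong (cf (c ⊙ y) w ℚ.+_) (cf-⊕ (y ⊙ c) (c ⋄ y) w)))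

  mergeWords-comm : ∀ v u → mergeWords v u ≡ mergeWords u v
  mergeWords-comm [] [] = refl
  mergeWords-comm [] (_ ∷ []) = refl
  mergeWords-comm [] (_ ∷ _ ∷ _) = refl
  mergeWords-comm ((s , i) ∷ []) [] = refl
  mergeWords-comm ((s , i) ∷ []) ((t , j) ∷ []) = cong (λ k → word (y₀ (suc k) ∷ [])) (ℕP.+-comm s t)
  mergeWords-comm ((s , i) ∷ []) (_ ∷ _ ∷ _) = refl
  mergeWords-comm (_ ∷ _ ∷ _) [] = refl
  mergeWords-comm (_ ∷ _ ∷ _) (_ ∷ []) = refl
  mergeWords-comm (_ ∷ _ ∷ _) (_ ∷ _ ∷ _) = refl

  ⋄-comm : ∀ x y → x ⋄ y ≃ y ⋄ x
  ⋄-comm x y = ≃-trans (Lin-swap mergeWords x y) (Lin-ext y (λ u → Lin-ext x (λ v → ≡⇒≃ (mergeWords-comm v u))))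

  mergeWords-assoc : ∀ v u r → Lin (λ t → mergeWords t r) (mergeWords v u) ≃ Lin (mergeWords v) (mergeWords u r)
  mergeWords-assoc [] u r = ≃-sym (Lin-fun-𝟘 (mergeWords u r))
  mergeWords-assoc (_ ∷ _ ∷ _) u r = ≃-sym (Lin-fun-𝟘 (mergeWords u r))
  mergeWords-assoc ((s , i) ∷ []) [] r = ≃-refl
  mergeWords-assoc ((s , i) ∷ []) (_ ∷ _ ∷ _) r = ≃-refl
  mergeWords-assoc ((s , i) ∷ []) ((t , j) ∷ []) [] = ≃-refl
  mergeWords-assoc ((s , i) ∷ []) ((t , j) ∷ []) (_ ∷ _ ∷ _) = ≃-refl
  mergeWords-assoc ((s , i) ∷ []) ((t , j) ∷ []) ((p , k) ∷ []) =
    ≃-trans (Lin-word (λ t' → mergeWords t' ((p , k) ∷ [])) (y₀ (suc (s + t)) ∷ []))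
      (≃-trans (≡⇒≃ (cong (λ q → word (y₀ (suc q) ∷ [])) (trans (cong suc (ℕP.+-assoc s t p)) (sym (ℕP.+-suc s (t + p))))))
          (≃-sym (Lin-word (mergeWords ((s , i) ∷ [])) (y₀ (suc (t + p)) ∷ []))))

  ⋄-assoc : ∀ x y z → (x ⋄ y) ⋄ z ≃ x ⋄ (y ⋄ z)
  ⋄-assoc x y z = begin
      (x ⋄ y) ⋄ z
    ≈⟨ Lin-comp (λ t → Lin (mergeWords t) z) (λ v → Lin (mergeWords v) y) x ⟩
      Lin (λ v → Lin (λ t → Lin (mergeWords t) z) (Lin (mergeWords v) y)) x
    ≈⟨ Lin-ext x (λ v → Lin-comp (λ t → Lin (mergeWords t) z) (mergeWords v) y) ⟩
      Lin (λ v → Lin (λ u → Lin (λ t → Lin (mergeWords t) z) (mergeWords v u)) y) x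
    ≈⟨ Lin-ext x (λ v → Lin-ext y (λ u → ≃-trans (Lin-swap mergeWords (mergeWords v u) z) (Lin-ext z (λ r → mergeWords-assoc v u r)))) ⟩
      Lin (λ v → Lin (λ u → Lin (λ r → Lin (mergeWords v) (mergeWords u r)) z) y) x
    ≈⟨ Lin-ext x (λ v → ≃-sym
        (≃-trans (Lin-comp (mergeWords v) (λ u → Lin (mergeWords u) z) y) (Lin-ext y (λ u → Lin-comp (mergeWords v) (mergeWords u) z)))) ⟩
      x ⋄ (y ⋄ z)
    ∎
    where open SR ≃-setoid


module PowerSeries (N : ℕ) {{nz : NonZero N}} where
  open Merge N public

  conv : ℕ → (ℕ → ℕ → 𝔸) → 𝔸
  conv zero F = F 0 0
  conv (suc m) F = F 0 (suc m) ⊕ conv m (λ i j → F (suc i) j)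

  conv-cong : ∀ m {F G} → (∀ i j → F i j ≃ G i j) → conv m F ≃ conv m G
  conv-cong zero e = e 0 0
  conv-cong (suc m) e = ⊕-cong (e 0 (suc m)) (conv-cong m (λ i j → e (suc i) j))

  conv-cong-on : ∀ m {F G} → (∀ i j → i + j ≡ m → F i j ≃ G i j) → conv m F ≃ conv m G
  conv-cong-on zero e = e 0 0 refl
  conv-cong-on (suc m) e = ⊕-cong (e 0 (suc m) refl) (conv-cong-on m (λ i j p → e (suc i) j (cong suc p)))

  conv-⊕ : ∀ m F G → conv m (λ i j → F i j ⊕ G i j) ≃ conv m F ⊕ conv m G
  conv-⊕ zero F G = ≃-refl
  conv-⊕ (suc m) F G = ≃-trans (⊕-cong (≃-refl {F 0 (suc m) ⊕ G 0 (suc m)}) (conv-⊕ m (λ i j → F (suc i) j) (λ i j → G (suc i) j)))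
     (⊕-interchange (F 0 (suc m)) (G 0 (suc m)) (conv m (λ i j → F (suc i) j)) (conv m (λ i j → G (suc i) j)))

  conv-linear : ∀ {L} → IsLinear L → ∀ m F → L (conv m F) ≃ conv m (λ i j → L (F i j))
  conv-linear Lr zero F = ≃-refl
  conv-linear {L} Lr (suc m) F = ≃-trans (map-⊕ Lr (F 0 (suc m)) _) (⊕-cong (≃-refl {L (F 0 (suc m))}) (conv-linear Lr m (λ i j → F (suc i) j)))

  conv-𝟘 : ∀ m → conv m (λ _ _ → 𝟘) ≃ 𝟘
  conv-𝟘 zero = ≃-refl
  conv-𝟘 (suc m) = conv-𝟘 m

  conv-last : ∀ m F → conv (suc m) F ≃ conv m (λ i j → F i (suc j)) ⊕ F (suc m) 0
  conv-last zero F = ≃-refl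
  conv-last (suc m) F = ≃-trans (⊕-cong (≃-refl {F 0 (suc (suc m))}) (conv-last m (λ i j → F (suc i) j))) (≃-sym (⊕-assoc (F 0 (suc (suc m))) _ _))

  conv-shift : ∀ m G H → (∀ i j → G (suc i) j ≃ H i (suc j)) → conv m G ⊕ H m 0 ≃ G 0 m ⊕ conv m H
  conv-shift zero G H e = ≃-refl
  conv-shift (suc m) G H e = ≃-trans (⊕-assoc (G 0 (suc m)) _ _) (⊕-cong (≃-refl {G 0 (suc m)})
      (≃-trans (⊕-cong (conv-cong m (λ i j → e i j)) (≃-refl {H (suc m) 0})) (≃-sym (conv-last m H))))

  conv-assoc : ∀ n (T : ℕ → ℕ → ℕ → 𝔸) → conv n (λ i j → conv i (λ p q → T p q j)) ≃ conv n (λ p r → conv r (λ q j → T p q j))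
  conv-assoc zero T = ≃-refl
  conv-assoc (suc m) T = begin
      T 0 0 (suc m) ⊕ conv m (λ i j → T 0 (suc i) j ⊕ conv i (λ p q → T (suc p) q j))
    ≈⟨ ⊕-cong (≃-refl {T 0 0 (suc m)}) (conv-⊕ m (λ i j → T 0 (suc i) j) (λ i j → conv i (λ p q → T (suc p) q j))) ⟩
      T 0 0 (suc m) ⊕ (conv m (λ i j → T 0 (suc i) j) ⊕ conv m (λ i j → conv i (λ p q → T (suc p) q j)))
    ≈⟨ ⊕-cong (≃-refl {T 0 0 (suc m)}) (⊕-cong (≃-refl {conv m (λ i j → T 0 (suc i) j)}) (conv-assoc m (λ p q j → T (suc p) q j))) ⟩
      T 0 0 (suc m) ⊕ (conv m (λ i j → T 0 (suc i) j) ⊕ conv m (λ p r → conv r (λ q j → T (suc p) q j)))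
    ≈⟨ ≃-sym (⊕-assoc (T 0 0 (suc m)) _ _) ⟩
      (T 0 0 (suc m) ⊕ conv m (λ i j → T 0 (suc i) j)) ⊕ conv m (λ p r → conv r (λ q j → T (suc p) q j))
    ∎
    where open SR ≃-setoid

  sumA-conv : ∀ n G → sumA N (applyUpTo (λ k → G k (n ℕ.∸ k)) (suc n)) ≃ conv n G
  sumA-conv zero G = ⊕-identityʳ (G 0 0)
  sumA-conv (suc n) G = ⊕-cong (≃-refl {G 0 (suc n)}) (sumA-conv n (λ i j → G (suc i) j))

  mulPS-conv : ∀ (X Y : ℕ → 𝔸) n → mulPS N X Y n ≃ conv n (λ i j → X i ⊙ Y j)
  mulPS-conv X Y n = ≃-trans (≡⇒≃ (cong (sumA N) (ListP.map-upTo (λ k → X k ⊙ Y (n ℕ.∸ k)) (suc n)))) (sumA-conv n (λ i j → X i ⊙ Y j))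

  Series : Set
  Series = ℕ → 𝔸

  _⋆_ : Series → Series → Series
  (f ⋆ g) n = conv n (λ i j → f i ⊙ g j)

  _≃S_ : Series → Series → Set
  f ≃S g = ∀ n → f n ≃ g n

  ⋆-cong : ∀ {f f' g g'} → f ≃S f' → g ≃S g' → (f ⋆ g) ≃S (f' ⋆ g')
  ⋆-cong p q n = conv-cong n (λ i j → ⊙-cong (p i) (q j))

  _⊞_ : Series → Series → Series
  (f ⊞ g) n = f n ⊕ g n

  _⊡_ : ℚ → Series → Series
  (c ⊡ f) n = c · f n

  ⋆-⊞ʳ : ∀ f g h → (f ⋆ (g ⊞ h)) ≃S ((f ⋆ g) ⊞ (f ⋆ h))
  ⋆-⊞ʳ f g h n = ≃-trans (conv-cong n (λ i j → ⊙-⊕ʳ (f i) (g j) (h j))) (conv-⊕ n _ _)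

  ⋆-⊞ˡ : ∀ f g h → ((f ⊞ g) ⋆ h) ≃S ((f ⋆ h) ⊞ (g ⋆ h))
  ⋆-⊞ˡ f g h n = ≃-trans (conv-cong n (λ i j → ⊙-⊕ˡ (f i) (g i) (h j))) (conv-⊕ n _ _)

  ⋆-⊡ʳ : ∀ c f g → (f ⋆ (c ⊡ g)) ≃S (c ⊡ (f ⋆ g))
  ⋆-⊡ʳ c f g n = ≃-trans (conv-cong n (λ i j → ⊙-·ʳ c (f i) (g j))) (≃-sym (conv-linear (·-linear c) n _))

  ⋆-⊡ˡ : ∀ c f g → ((c ⊡ f) ⋆ g) ≃S (c ⊡ (f ⋆ g))
  ⋆-⊡ˡ c f g n = ≃-trans (conv-cong n (λ i j → ⊙-·ˡ c (f i) (g j))) (≃-sym (conv-linear (·-linear c) n _))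

  ⋆-assoc : ∀ f g h → ((f ⋆ g) ⋆ h) ≃S (f ⋆ (g ⋆ h))
  ⋆-assoc f g h n = ≃-trans (conv-cong n (λ i j → conv-linear (⊙-linearˡ (h j)) i (λ p q → f p ⊙ g q)))
     (≃-trans (conv-assoc n (λ p q j → (f p ⊙ g q) ⊙ h j))
       (conv-cong n (λ p r → ≃-trans (conv-cong r (λ q j → ⊙-assoc (f p) (g q) (h j)))
           (≃-sym (conv-linear (⊙-linearʳ (f p)) r (λ q j → g q ⊙ h j))))))

  δ : Series
  δ = oneP N

  ⋆-identityˡ : ∀ f → (δ ⋆ f) ≃S f
  ⋆-identityˡ f zero = ⊙-𝟙ˡ (f 0)
  ⋆-identityˡ f (suc m) = ≃-trans (⊕-cong (⊙-𝟙ˡ (f (suc m))) (conv-𝟘 m)) (⊕-identityʳ (f (suc m)))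

  ⋆-identityʳ : ∀ f → (f ⋆ δ) ≃S f
  ⋆-identityʳ f zero = ⊙-𝟙ʳ (f 0)
  ⋆-identityʳ f (suc m) = ≃-trans (conv-last m (λ i j → f i ⊙ δ j))
      (≃-trans (⊕-cong (≃-trans (conv-cong m (λ i j → ⊙-𝟘ʳ (f i))) (conv-𝟘 m)) (⊙-𝟙ʳ (f (suc m)))) (⊕-identityˡ (f (suc m))))

  ΣL-conv : ∀ m T → ΣL m (λ k → conv k T) ≃ ΣL m (λ i → ΣL (m ∸ i) (T i))
  ΣL-conv zero T = ≃-refl
  ΣL-conv (suc m) T =
    ≃-trans (⊕-cong (≃-refl {T 0 0}) (≃-trans (ΣL-⊕ m (λ k → T 0 (suc k)) (λ k → conv k T'))
                                             (⊕-cong (≃-refl {ΣL m (λ k → T 0 (suc k))}) (ΣL-conv m T'))))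
            (≃-sym (⊕-assoc (T 0 0) _ _))
    where
    T' : ℕ → ℕ → 𝔸
    T' i j = T (suc i) j

  1⊖_ : Series → Series
  1⊖ G = δ ⊞ ((ℚ.- 1ℚ) ⊡ G)

  -- D = (a - 1) - a G satisfies G D = D, and G has no constant term, so D vanishes degree by degree.
  module InverseOfFixpoint (a G : Series) (G₀≃𝟘 : G 0 ≃ 𝟘) (G⋆a≃a⊖δ : ∀ n → (G ⋆ a) n ≃ a n ⊖ δ n) where

    private
      D : Series
      D n = (a n ⊖ δ n) ⊖ (a ⋆ G) n

      G⋆[a⋆G] : ∀ n → (G ⋆ (a ⋆ G)) n ≃ (a ⋆ G) n ⊖ G n
      G⋆[a⋆G] n = begin
          (G ⋆ (a ⋆ G)) n
        ≈⟨ ≃-sym (⋆-assoc G a G n) ⟩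
          ((G ⋆ a) ⋆ G) n
        ≈⟨ ⋆-cong {G ⋆ a} {a ⊞ ((ℚ.- 1ℚ) ⊡ δ)} G⋆a≃a⊖δ (λ _ → ≃-refl) n ⟩
          ((a ⊞ ((ℚ.- 1ℚ) ⊡ δ)) ⋆ G) n
        ≈⟨ ⋆-⊞ˡ a ((ℚ.- 1ℚ) ⊡ δ) G n ⟩
          (a ⋆ G) n ⊕ (((ℚ.- 1ℚ) ⊡ δ) ⋆ G) n
        ≈⟨ ⊕-cong (≃-refl {(a ⋆ G) n}) (≃-trans (⋆-⊡ˡ (ℚ.- 1ℚ) δ G n) (·-cong (ℚ.- 1ℚ) (⋆-identityˡ G n))) ⟩
          (a ⋆ G) n ⊖ G n
        ∎
        where open SR ≃-setoid

      G⋆D≃D : ∀ n → (G ⋆ D) n ≃ D n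
      G⋆D≃D n = begin
          (G ⋆ D) n
        ≈⟨ ⋆-⊞ʳ G (λ k → a k ⊖ δ k) (λ k → (ℚ.- 1ℚ) · (a ⋆ G) k) n ⟩
          (G ⋆ (λ k → a k ⊖ δ k)) n ⊕ (G ⋆ ((ℚ.- 1ℚ) ⊡ (a ⋆ G))) n
        ≈⟨ ⊕-cong (⋆-⊞ʳ G a ((ℚ.- 1ℚ) ⊡ δ) n) (⋆-⊡ʳ (ℚ.- 1ℚ) G (a ⋆ G) n) ⟩
          ((G ⋆ a) n ⊕ (G ⋆ ((ℚ.- 1ℚ) ⊡ δ)) n) ⊕ (ℚ.- 1ℚ) · (G ⋆ (a ⋆ G)) n
        ≈⟨ ⊕-cong (⊕-cong (G⋆a≃a⊖δ n) (≃-trans (⋆-⊡ʳ (ℚ.- 1ℚ) G δ n) (·-cong (ℚ.- 1ℚ) (⋆-identityʳ G n)))) (·-cong (ℚ.- 1ℚ) (G⋆[a⋆G] n)) ⟩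
          ((a n ⊖ δ n) ⊖ G n) ⊖ ((a ⋆ G) n ⊖ G n)
        ≈⟨ [x⊖z]⊖[y⊖z]≃x⊖y (a n ⊖ δ n) ((a ⋆ G) n) (G n) ⟩
          D n
        ∎
        where open SR ≃-setoid

      D≃𝟘 : ∀ n k → k ℕ.≤ n → D k ≃ 𝟘
      D≃𝟘 zero .zero ℕ.z≤n = ≃-trans (≃-sym (G⋆D≃D 0)) (⊙-cong G₀≃𝟘 (≃-refl {D 0}))
      D≃𝟘 (suc n) k k≤1+n with ℕP.m≤n⇒m<n∨m≡n k≤1+n
      ... | inj₁ (ℕ.s≤s k≤n) = D≃𝟘 n k k≤n
      ... | inj₂ refl = ≃-trans (≃-sym (G⋆D≃D (suc n))) (⊕-cong (⊙-cong G₀≃𝟘 (≃-refl {D (suc n)})) earlier≃𝟘)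
        where
        earlier≃𝟘 : conv n (λ i j → G (suc i) ⊙ D j) ≃ 𝟘
        earlier≃𝟘 = ≃-trans (conv-cong-on n
            (λ i j i+j≡n → ≃-trans (⊙-cong (≃-refl {G (suc i)}) (D≃𝟘 n j (subst (j ℕ.≤_) i+j≡n (ℕP.m≤n+m j i)))) (⊙-𝟘ʳ (G (suc i)))))
                            (conv-𝟘 n)

    a⋆G≃a⊖δ : ∀ n → (a ⋆ G) n ≃ a n ⊖ δ n
    a⋆G≃a⊖δ n = ≃-sym (x⊖y≃𝟘⇒x≃y (D≃𝟘 n n ℕP.≤-refl))

    ⋆-inverseʳ : ∀ n → (a ⋆ (1⊖ G)) n ≃ δ n
    ⋆-inverseʳ n = begin
        (a ⋆ (1⊖ G)) n
      ≈⟨ ⋆-⊞ʳ a δ ((ℚ.- 1ℚ) ⊡ G) n ⟩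
        (a ⋆ δ) n ⊕ (a ⋆ ((ℚ.- 1ℚ) ⊡ G)) n
      ≈⟨ ⊕-cong (⋆-identityʳ a n) (≃-trans (⋆-⊡ʳ (ℚ.- 1ℚ) a G n) (·-cong (ℚ.- 1ℚ) (a⋆G≃a⊖δ n))) ⟩
        a n ⊖ (a n ⊖ δ n)
      ≈⟨ x⊖[x⊖y]≃y (a n) (δ n) ⟩
        δ n
      ∎
      where open SR ≃-setoid

    ⋆-inverseˡ : ∀ n → ((1⊖ G) ⋆ a) n ≃ δ n
    ⋆-inverseˡ n = begin
        ((1⊖ G) ⋆ a) n
      ≈⟨ ⋆-⊞ˡ δ ((ℚ.- 1ℚ) ⊡ G) a n ⟩
        (δ ⋆ a) n ⊕ (((ℚ.- 1ℚ) ⊡ G) ⋆ a) n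
      ≈⟨ ⊕-cong (⋆-identityˡ a n) (≃-trans (⋆-⊡ˡ (ℚ.- 1ℚ) G a n) (·-cong (ℚ.- 1ℚ) (G⋆a≃a⊖δ n))) ⟩
        a n ⊖ (a n ⊖ δ n)
      ≈⟨ x⊖[x⊖y]≃y (a n) (δ n) ⟩
        δ n
      ∎
      where open SR ≃-setoid

module ExpStuffle (N : ℕ) {{nz : NonZero N}} where
  open PowerSeries N public
  open +-*-Solver

  iF : ℕ → ℚ
  iF = invFact N

  iF-inverse : ∀ n → iF n ℚ.* fromℕ (n !) ≡ 1ℚ
  iF-inverse n = *-inverseˡ-fromℕ (n !) {{ℕP._!≢0 n}}

  iF-binomial : ∀ i j → iF (suc (i + j)) ℚ.* fromℕ (binomial (suc i) j) ≡ iF (suc i) ℚ.* iF j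
  iF-binomial i j =
    reciprocal-rescale (iF (suc (i + j))) (fromℕ (binomial (suc i) j)) (iF (suc i)) (iF j) (iF-inverse (suc (i + j))) (iF-inverse (suc i))
        (iF-inverse j)
      (trans (cong (fromℕ (binomial (suc i) j) ℚ.*_) (sym (fromℕ-* (suc i !) (j !))))
             (trans (sym (fromℕ-* (binomial (suc i) j) _)) (cong fromℕ (binomial-factorial (suc i) j))))

  ⋄pow : ℕ → 𝔸 → 𝔸
  ⋄pow zero x = 𝟙
  ⋄pow (suc zero) x = x
  ⋄pow (suc (suc n)) x = ⋄pow (suc n) x ⋄ x

  In𝔷-⋄pow : ∀ {x} → In𝔷 x → ∀ n → In𝔷 (⋄pow (suc n) x)
  In𝔷-⋄pow x∈𝔷 zero = x∈𝔷
  In𝔷-⋄pow {x} x∈𝔷 (suc n) = In𝔷-⋄ (⋄pow (suc n) x) x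

  circPow≃⋄pow : ∀ {x} → In𝔷 x → ∀ n → circPow N n x ≃ ⋄pow n x
  circPow≃⋄pow x∈𝔷 zero = ≃-refl
  circPow≃⋄pow x∈𝔷 (suc zero) = ≃-refl
  circPow≃⋄pow {x} x∈𝔷 (suc (suc n)) = ≃-trans (⊚-cong (circPow≃⋄pow x∈𝔷 (suc n)) (≃-refl {x})) (⊚-𝔷 (In𝔷-⋄pow x∈𝔷 n) x∈𝔷)

  -- a k and g k are the coefficients of u^k in exp_*(xu) and exp_⋄(xu).
  module StufflePowers (x : 𝔸) (x∈𝔷 : In𝔷 x) where
    P c : ℕ → 𝔸
    P k = starPow N k x
    c k = ⋄pow k x

    binomialTerm prepended starred merged : ℕ → ℕ → 𝔸
    binomialTerm i j = fromℕ (binomial (suc i) j) · (c (suc i) ⊙ P j)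
    prepended i j = fromℕ (binomial (suc i) j) · ((x ⊙ c (suc i)) ⊙ P j)
    starred i j = fromℕ (binomial (suc i) j) · (c (suc i) ⊙ P (suc j))
    merged i j = fromℕ (binomial (suc i) j) · (c (suc (suc i)) ⊙ P j)

    x✶binomialTerm : ∀ i j → x ✶ binomialTerm i j ≃ prepended i j ⊕ (starred i j ⊕ merged i j)
    x✶binomialTerm i j = begin
        x ✶ (b · (c (suc i) ⊙ P j))
      ≈⟨ ≃-trans (✶-·ʳ b x (c (suc i) ⊙ P j)) (·-cong b (✶-⊙-expansion x∈𝔷 (In𝔷-⋄pow x∈𝔷 i) (P j))) ⟩
        b · ((x ⊙ c (suc i)) ⊙ P j ⊕ (c (suc i) ⊙ P (suc j) ⊕ (x ⋄ c (suc i)) ⊙ P j))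
      ≈⟨ ≃-trans (·-distribˡ-⊕ b ((x ⊙ c (suc i)) ⊙ P j) _)
          (⊕-cong (≃-refl {prepended i j}) (·-distribˡ-⊕ b (c (suc i) ⊙ P (suc j)) ((x ⋄ c (suc i)) ⊙ P j))) ⟩
        prepended i j ⊕ (starred i j ⊕ b · ((x ⋄ c (suc i)) ⊙ P j))
      ≈⟨ ⊕-cong (≃-refl {prepended i j}) (⊕-cong (≃-refl {starred i j}) (·-cong b (⊙-cong (⋄-comm x (c (suc i))) (≃-refl {P j})))) ⟩
        prepended i j ⊕ (starred i j ⊕ merged i j)
      ∎
      where
      open SR ≃-setoid
      b : ℚ
      b = fromℕ (binomial (suc i) j)

    binomialTerm-pascal : ∀ m → conv (suc m) binomialTerm ≃ x ⊙ P (suc m) ⊕ (conv m starred ⊕ conv m merged)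
    binomialTerm-pascal m = begin
        conv (suc m) binomialTerm
      ≈⟨ conv-last m binomialTerm ⟩
        conv m (λ i j → binomialTerm i (suc j)) ⊕ binomialTerm (suc m) 0
      ≈⟨ ⊕-cong (≃-trans (conv-cong m split) (conv-⊕ m left starred)) (≃-refl {merged m 0}) ⟩
        (conv m left ⊕ conv m starred) ⊕ merged m 0
      ≈⟨ ⊕-right-comm (conv m left) (conv m starred) (merged m 0) ⟩
        (conv m left ⊕ merged m 0) ⊕ conv m starred
      ≈⟨ ⊕-cong (conv-shift m left merged (λ i j → ≃-refl)) (≃-refl {conv m starred}) ⟩
        (left 0 m ⊕ conv m merged) ⊕ conv m starred
      ≈⟨ ⊕-assoc-comm (left 0 m) (conv m starred) (conv m merged) ⟩
        left 0 m ⊕ (conv m starred ⊕ conv m merged)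
      ≈⟨ ⊕-cong (·-identityˡ (x ⊙ P (suc m))) (≃-refl {conv m starred ⊕ conv m merged}) ⟩
        x ⊙ P (suc m) ⊕ (conv m starred ⊕ conv m merged)
      ∎
      where
      open SR ≃-setoid
      left : ℕ → ℕ → 𝔸
      left i j = fromℕ (binomial i (suc j)) · (c (suc i) ⊙ P (suc j))
      split : ∀ i j → binomialTerm i (suc j) ≃ left i j ⊕ starred i j
      split i j = ≃-trans (·-congˡ (c (suc i) ⊙ P (suc j)) (fromℕ-+ (binomial i (suc j)) (binomial (suc i) j)))
                          (·-distribʳ-+ (fromℕ (binomial i (suc j))) (fromℕ (binomial (suc i) j)) (c (suc i) ⊙ P (suc j)))

    stufflePower-binomial : ∀ m → P (suc m) ≃ conv m binomialTerm
    stufflePower-binomial zero = ≃-trans (✶-𝟙ʳ x) (≃-sym (≃-trans (·-identityˡ (x ⊙ 𝟙)) (⊙-𝟙ʳ x)))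
    stufflePower-binomial (suc m) = begin
        x ✶ P (suc m)
      ≈⟨ ✶-cong (≃-refl {x}) (stufflePower-binomial m) ⟩
        x ✶ conv m binomialTerm
      ≈⟨ ≃-trans (conv-linear (✶-linearʳ x) m binomialTerm) (conv-cong m x✶binomialTerm) ⟩
        conv m (λ i j → prepended i j ⊕ (starred i j ⊕ merged i j))
      ≈⟨ ≃-trans (conv-⊕ m prepended _) (⊕-cong (≃-refl {conv m prepended}) (conv-⊕ m starred merged)) ⟩
        conv m prepended ⊕ (conv m starred ⊕ conv m merged)
      ≈⟨ ⊕-cong prepended-sum (≃-refl {conv m starred ⊕ conv m merged}) ⟩
        x ⊙ P (suc m) ⊕ (conv m starred ⊕ conv m merged)
      ≈⟨ ≃-sym (binomialTerm-pascal m) ⟩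
        conv (suc m) binomialTerm
      ∎
      where
      open SR ≃-setoid
      prepended-sum : conv m prepended ≃ x ⊙ P (suc m)
      prepended-sum =
        ≃-trans (conv-cong m (λ i j → ≃-trans (·-cong (fromℕ (binomial (suc i) j)) (⊙-assoc x (c (suc i)) (P j)))
                                               (≃-sym (⊙-·ʳ (fromℕ (binomial (suc i) j)) x (c (suc i) ⊙ P j)))))
                (≃-trans (≃-sym (conv-linear (⊙-linearʳ x) m binomialTerm)) (⊙-cong (≃-refl {x}) (≃-sym (stufflePower-binomial m))))

    a g : ℕ → 𝔸
    a k = iF k · P k
    g k = iF k · c k

    expStar-recurrence : ∀ m → a (suc m) ≃ conv m (λ i j → g (suc i) ⊙ a j)
    expStar-recurrence m =
      ≃-trans (·-cong (iF (suc m)) (stufflePower-binomial m))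
              (≃-trans (conv-linear (·-linear (iF (suc m))) m binomialTerm) (conv-cong-on m rescale))
      where
      rescale : ∀ i j → i + j ≡ m → iF (suc m) · binomialTerm i j ≃ g (suc i) ⊙ a j
      rescale i j refl = ≃-trans (·-assoc (iF (suc (i + j))) (fromℕ (binomial (suc i) j)) (c (suc i) ⊙ P j))
         (≃-trans (·-congˡ (c (suc i) ⊙ P j) (iF-binomial i j))
         (≃-trans (≃-sym (·-assoc (iF (suc i)) (iF j) (c (suc i) ⊙ P j)))
         (≃-trans (·-cong (iF (suc i)) (≃-sym (⊙-·ʳ (iF j) (c (suc i)) (P j)))) (≃-sym (⊙-·ˡ (iF (suc i)) (c (suc i)) (a j))))))

    G : Series
    G zero = 𝟘
    G (suc k) = g (suc k)

    G⋆a≃a⊖δ : ∀ n → (G ⋆ a) n ≃ a n ⊖ δ n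
    G⋆a≃a⊖δ zero = ⟨ (λ w → sym (trans (cf-⊖ (a 0) 𝟙 w) (trans (cong (ℚ._- cf 𝟙 w) (at (·-identityˡ 𝟙) w)) (ℚP.+-inverseʳ (cf 𝟙 w))))) ⟩
    G⋆a≃a⊖δ (suc m) = ≃-trans (≃-sym (expStar-recurrence m)) (≃-sym (⊕-identityʳ (a (suc m))))

    twoMinusExpCirc≃1⊖G : ∀ n → twoMinusExpCirc N x n ≃ (1⊖ G) n
    twoMinusExpCirc≃1⊖G zero = ⟨ (λ w → trans (cf-⊖ ((ℤ.+ 2 ℚ./ 1) · 𝟙) (iF 0 · 𝟙) w)
      (trans (cong₂ ℚ._-_ (cf-· (ℤ.+ 2 ℚ./ 1) 𝟙 w) (cf-· (iF 0) 𝟙 w))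
        (trans (solve 1 (λ c → con (ℤ.+ 2 ℚ./ 1) :* c :- con 1ℚ :* c := c :+ con 0ℚ) refl (cf 𝟙 w)) (sym (cf-⊕ 𝟙 ((ℚ.- 1ℚ) · 𝟘) w))))) ⟩
    twoMinusExpCirc≃1⊖G (suc k) = ⊕-cong (≃-refl {𝟘}) (·-cong (ℚ.- 1ℚ) (·-cong (iF (suc k)) (circPow≃⋄pow x∈𝔷 (suc k))))

  expStar-inverse : ∀ z → In𝔷 z → IsInverseP N (expStarPS N z) (twoMinusExpCirc N z)
  expStar-inverse z z∈𝔷 = (λ n → at (inverseʳ n)) , (λ n → at (inverseˡ n))
    where
    open StufflePowers z z∈𝔷
    open InverseOfFixpoint a G ≃-refl G⋆a≃a⊖δ
    F : Series
    F = twoMinusExpCirc N z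
    inverseʳ : ∀ n → mulPS N a F n ≃ δ n
    inverseʳ n = ≃-trans (mulPS-conv a F n) (≃-trans (⋆-cong {a} {a} (λ _ → ≃-refl) twoMinusExpCirc≃1⊖G n) (⋆-inverseʳ n))
    inverseˡ : ∀ n → mulPS N F a n ≃ δ n
    inverseˡ n = ≃-trans (mulPS-conv F a n) (≃-trans (⋆-cong {F} {1⊖ G} twoMinusExpCirc≃1⊖G (λ _ → ≃-refl) n) (⋆-inverseˡ n))


module Weights (N : ℕ) {{nz : NonZero N}} where
  open ExpStuffle N public

  wt : Wd → ℕ
  wt = weight N

  weight-++ : ∀ v u → wt (v ++ u) ≡ wt v + wt u
  weight-++ [] u = refl
  weight-++ ((s , i) ∷ v) u = trans (cong (suc s +_) (weight-++ v u)) (sym (ℕP.+-assoc (suc s) (wt v) (wt u)))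

  record Ord≥ (k : ℕ) (x : 𝔸) : Set where
    constructor ord⟨_⟩
    field below : ∀ w → wt w < k → cf x w ≡ 0ℚ
  open Ord≥ public

  AllWeight≥ : ℕ → 𝔸 → Set
  AllWeight≥ k x = All (λ e → k ≤ wt (proj₂ e)) x

  AllWeight≥-mono : ∀ {k k' x} → k ≤ k' → AllWeight≥ k' x → AllWeight≥ k x
  AllWeight≥-mono le [] = []
  AllWeight≥-mono le (p ∷ ps) = ℕP.≤-trans le p ∷ AllWeight≥-mono le ps

  AllWeight≥-⊕ : ∀ {k x y} → AllWeight≥ k x → AllWeight≥ k y → AllWeight≥ k (x ⊕ y)
  AllWeight≥-⊕ [] q = q
  AllWeight≥-⊕ (p ∷ ps) q = p ∷ AllWeight≥-⊕ ps q

  AllWeight≥-· : ∀ {k} c {x} → AllWeight≥ k x → AllWeight≥ k (c · x)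
  AllWeight≥-· c [] = []
  AllWeight≥-· c (p ∷ ps) = p ∷ AllWeight≥-· c ps

  AllWeight≥-Lin : ∀ {k} {P : Wd → Set} f x → All (λ e → P (proj₂ e)) x → (∀ v → P v → AllWeight≥ k (f v)) → AllWeight≥ k (Lin f x)
  AllWeight≥-Lin f [] [] h = []
  AllWeight≥-Lin f ((c , v) ∷ x) (p ∷ ps) h = AllWeight≥-⊕ (AllWeight≥-· c (h v p)) (AllWeight≥-Lin f x ps h)

  Superadditive : (Wd → Wd → 𝔸) → Set
  Superadditive h = ∀ v u → AllWeight≥ (wt v + wt u) (h v u)

  AllWeight≥-Bil : ∀ {a b} h x y → AllWeight≥ a x → AllWeight≥ b y → Superadditive h → AllWeight≥ (a + b) (Bil h x y)
  AllWeight≥-Bil {a} {b} h x y px py sh = AllWeight≥-Lin _ x px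
      (λ v av → AllWeight≥-Lin (h v) y py (λ u bu → AllWeight≥-mono (ℕP.+-mono-≤ av bu) (sh v u)))

  AllWeight≥⇒Ord≥ : ∀ {k x} → AllWeight≥ k x → Ord≥ k x
  AllWeight≥⇒Ord≥ {k} {x} p = ord⟨ (λ w l → go x p w l) ⟩
    where
    go : ∀ x → AllWeight≥ k x → ∀ w → wt w < k → cf x w ≡ 0ℚ
    go [] [] w l = refl
    go ((c , v) ∷ x) (q ∷ qs) w l with v ≟w w
    ... | yes refl = ⊥-elim (ℕP.<-irrefl refl (ℕP.<-≤-trans l q))
    ... | no _ = go x qs w l

  dropBelow : ℕ → 𝔸 → 𝔸
  dropBelow k [] = []
  dropBelow k ((c , v) ∷ x) with k ℕ.≤? wt v
  ... | yes _ = (c , v) ∷ dropBelow k x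
  ... | no _ = dropBelow k x

  AllWeight≥-dropBelow : ∀ k x → AllWeight≥ k (dropBelow k x)
  AllWeight≥-dropBelow k [] = []
  AllWeight≥-dropBelow k ((c , v) ∷ x) with k ℕ.≤? wt v
  ... | yes p = p ∷ AllWeight≥-dropBelow k x
  ... | no _ = AllWeight≥-dropBelow k x

  cf-dropBelow-≥ : ∀ k x w → k ≤ wt w → cf (dropBelow k x) w ≡ cf x w
  cf-dropBelow-≥ k [] w k≤w = refl
  cf-dropBelow-≥ k ((c , v) ∷ x) w k≤w with k ℕ.≤? wt v
  ... | yes _ = cf-∷-cong c v w (cf-dropBelow-≥ k x w k≤w)
  ... | no k≰v = trans (cf-dropBelow-≥ k x w k≤w) (sym (cf-∷-≢ c v x w (λ { refl → k≰v k≤w })))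

  cf-dropBelow-< : ∀ k x w → wt w < k → cf (dropBelow k x) w ≡ 0ℚ
  cf-dropBelow-< k x w l = below (AllWeight≥⇒Ord≥ (AllWeight≥-dropBelow k x)) w l

  Ord≥⇒≃dropBelow : ∀ {k x} → Ord≥ k x → x ≃ dropBelow k x
  Ord≥⇒≃dropBelow {k} {x} h = ⟨ coefficient ⟩
    where
    coefficient : ∀ w → cf x w ≡ cf (dropBelow k x) w
    coefficient w with k ℕ.≤? wt w
    ... | yes le = sym (cf-dropBelow-≥ k x w le)
    ... | no ¬le = trans (below h w (ℕP.≰⇒> ¬le)) (sym (cf-dropBelow-< k x w (ℕP.≰⇒> ¬le)))

  Ord≥-resp : ∀ {k x y} → x ≃ y → Ord≥ k y → Ord≥ k x
  Ord≥-resp p h = ord⟨ (λ w l → trans (at p w) (below h w l)) ⟩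

  Ord≥-0 : ∀ x → Ord≥ 0 x
  Ord≥-0 x = ord⟨ (λ w ()) ⟩

  Ord≥-mono : ∀ {k k' x} → k ≤ k' → Ord≥ k' x → Ord≥ k x
  Ord≥-mono le h = ord⟨ (λ w l → below h w (ℕP.<-≤-trans l le)) ⟩

  Ord≥-⊕ : ∀ {k x y} → Ord≥ k x → Ord≥ k y → Ord≥ k (x ⊕ y)
  Ord≥-⊕ {k} {x} {y} p q = ord⟨ (λ w l → trans (cf-⊕ x y w) (trans (cong₂ ℚ._+_ (below p w l) (below q w l)) (ℚP.+-identityˡ 0ℚ))) ⟩

  Ord≥-· : ∀ {k} c {x} → Ord≥ k x → Ord≥ k (c · x)
  Ord≥-· c {x} p = ord⟨ (λ w l → trans (cf-· c x w) (trans (cong (c ℚ.*_) (below p w l)) (ℚP.*-zeroʳ c))) ⟩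

  Ord≥-𝟘 : ∀ {k} → Ord≥ k 𝟘
  Ord≥-𝟘 = ord⟨ (λ w l → refl) ⟩

  Ord≥-Bil : ∀ {a b} h {x y} → Superadditive h → Ord≥ a x → Ord≥ b y → Ord≥ (a + b) (Bil h x y)
  Ord≥-Bil {a} {b} h {x} {y} sh p q = Ord≥-resp (Bil-cong h (Ord≥⇒≃dropBelow p) (Ord≥⇒≃dropBelow q))
      (AllWeight≥⇒Ord≥ (AllWeight≥-Bil h _ _ (AllWeight≥-dropBelow a x) (AllWeight≥-dropBelow b y) sh))

  concatWords-superadditive : Superadditive concatWords
  concatWords-superadditive v u = ℕP.≤-reflexive (sym (weight-++ v u)) ∷ []

  weight-merge : ∀ s i t j → wt ((s , i) ∷ []) + wt ((t , j) ∷ []) ≡ wt (y₀ (suc (s + t)) ∷ [])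
  weight-merge s i t j rewrite ℕP.+-identityʳ s | ℕP.+-identityʳ t | ℕP.+-identityʳ (s + t) = cong suc (ℕP.+-suc s t)

  mergeWords-superadditive : Superadditive mergeWords
  mergeWords-superadditive [] u = []
  mergeWords-superadditive ((s , i) ∷ []) [] = []
  mergeWords-superadditive ((s , i) ∷ []) ((t , j) ∷ []) = ℕP.≤-reflexive (weight-merge s i t j) ∷ []
  mergeWords-superadditive ((s , i) ∷ []) (_ ∷ _ ∷ _) = []
  mergeWords-superadditive (_ ∷ _ ∷ _) u = []

  AllWeight≡ : ℕ → 𝔸 → Set
  AllWeight≡ n x = All (λ e → wt (proj₂ e) ≡ n) x

  AllWeight≡-⊕ : ∀ {k x y} → AllWeight≡ k x → AllWeight≡ k y → AllWeight≡ k (x ⊕ y)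
  AllWeight≡-⊕ [] q = q
  AllWeight≡-⊕ (p ∷ ps) q = p ∷ AllWeight≡-⊕ ps q

  weight-τ : ∀ j u → wt (τ N j u) ≡ wt u
  weight-τ j [] = refl
  weight-τ j ((s , i) ∷ u) = cong (suc s +_) (weight-τ j u)

  AllWeight≡-τA : ∀ {k} j x → AllWeight≡ k x → AllWeight≡ k (τA N j x)
  AllWeight≡-τA j [] [] = []
  AllWeight≡-τA j ((c , u) ∷ x) (p ∷ ps) = trans (weight-τ j u) p ∷ AllWeight≡-τA j x ps

  AllWeight≡-prefix : ∀ {k} l x → AllWeight≡ k x → AllWeight≡ (suc (proj₁ l) + k) (Defs.[_] N l ⊙ x)
  AllWeight≡-prefix l [] [] = []
  AllWeight≡-prefix l ((d , u) ∷ x) (p ∷ ps) = cong (suc (proj₁ l) +_) p ∷ AllWeight≡-prefix l x ps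

  AllWeight≡-stF : ∀ f v u → AllWeight≡ (wt v + wt u) (stF N f v u)
  AllWeight≡-stF f [] u = refl ∷ []
  AllWeight≡-stF f (l ∷ v) [] = sym (ℕP.+-identityʳ _) ∷ []
  AllWeight≡-stF zero (_ ∷ _) (_ ∷ _) = []
  AllWeight≡-stF (suc f) ((s , j) ∷ w₁) ((t , k) ∷ w₂) =
    AllWeight≡-⊕ {x = X1}
        (subst (λ n → AllWeight≡ n X1) e1 (AllWeight≡-prefix (s , j) _ (AllWeight≡-τA j _ (AllWeight≡-stF f (τ N (negF N j) w₁) ((t , k) ∷ w₂)))))
     (AllWeight≡-⊕ {x = X2}
         (subst (λ n → AllWeight≡ n X2) e2 (AllWeight≡-prefix (t , k) _ (AllWeight≡-τA k _ (AllWeight≡-stF f ((s , j) ∷ w₁) (τ N (negF N k) w₂)))))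
       (subst (λ n → AllWeight≡ n X3) e3
           (AllWeight≡-prefix (suc (s + t) , _+F_ N j k) _
           (AllWeight≡-τA (_+F_ N j k) _ (AllWeight≡-stF f (τ N (negF N j) w₁) (τ N (negF N k) w₂))))))
    where
    a b : ℕ
    a = wt w₁
    b = wt w₂
    X1 X2 X3 : 𝔸
    X1 = Defs.[_] N (s , j) ⊙ τA N j (stF N f (τ N (negF N j) w₁) ((t , k) ∷ w₂))
    X2 = Defs.[_] N (t , k) ⊙ τA N k (stF N f ((s , j) ∷ w₁) (τ N (negF N k) w₂))
    X3 = Defs.[_] N (suc (s + t) , _+F_ N j k) ⊙ τA N (_+F_ N j k) (stF N f (τ N (negF N j) w₁) (τ N (negF N k) w₂))
    open ℕ-Solver.+-*-Solver
    e1 : suc s + (wt (τ N (negF N j) w₁) + (suc t + b)) ≡ (suc s + a) + (suc t + b)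
    e1 rewrite weight-τ (negF N j) w₁ = sym (ℕP.+-assoc (suc s) a (suc t + b))
    e2 : suc t + ((suc s + a) + wt (τ N (negF N k) w₂)) ≡ (suc s + a) + (suc t + b)
    e2 rewrite weight-τ (negF N k) w₂ =
      solve 4 (λ s t a b → (con 1 :+ t) :+ (((con 1 :+ s) :+ a) :+ b) := ((con 1 :+ s) :+ a) :+ ((con 1 :+ t) :+ b)) refl s t a b
    e3 : suc (suc (s + t)) + (wt (τ N (negF N j) w₁) + wt (τ N (negF N k) w₂)) ≡ (suc s + a) + (suc t + b)
    e3 rewrite weight-τ (negF N j) w₁ | weight-τ (negF N k) w₂ =
      solve 4 (λ s t a b → (con 2 :+ (s :+ t)) :+ (a :+ b) := ((con 1 :+ s) :+ a) :+ ((con 1 :+ t) :+ b)) refl s t a b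

  AllWeight≡⇒AllWeight≥ : ∀ {k x} → AllWeight≡ k x → AllWeight≥ k x
  AllWeight≡⇒AllWeight≥ [] = []
  AllWeight≡⇒AllWeight≥ (p ∷ ps) = ℕP.≤-reflexive (sym p) ∷ AllWeight≡⇒AllWeight≥ ps

  stuffleWords-superadditive : Superadditive stuffleWords
  stuffleWords-superadditive v u = AllWeight≡⇒AllWeight≥ (AllWeight≡-stF _ v u)

  Ord≥-⊙ : ∀ {a b x y} → Ord≥ a x → Ord≥ b y → Ord≥ (a + b) (x ⊙ y)
  Ord≥-⊙ {x = x} {y} p q = Ord≥-resp (⊙-Bil x y) (Ord≥-Bil concatWords concatWords-superadditive p q)

  Ord≥-✶ : ∀ {a b x y} → Ord≥ a x → Ord≥ b y → Ord≥ (a + b) (x ✶ y)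
  Ord≥-✶ {x = x} {y} p q = Ord≥-resp (✶-Bil x y) (Ord≥-Bil stuffleWords stuffleWords-superadditive p q)

  Ord≥-⋄ : ∀ {a b x y} → Ord≥ a x → Ord≥ b y → Ord≥ (a + b) (x ⋄ y)
  Ord≥-⋄ p q = Ord≥-Bil mergeWords mergeWords-superadditive p q


module WeightApproximation (N : ℕ) {{nz : NonZero N}} where
  open Weights N public
  open +-*-Solver

  record _≈[_]_ (x : 𝔸) (W : ℕ) (y : 𝔸) : Set where
    constructor ap⟨_⟩
    field ap : ∀ w → wt w ≤ W → cf x w ≡ cf y w
  open _≈[_]_ public
  infix 4 _≈[_]_

  ≃⇒≈ : ∀ {W x y} → x ≃ y → x ≈[ W ] y
  ≃⇒≈ p = ap⟨ (λ w _ → at p w) ⟩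

  ≈-refl : ∀ {W x} → x ≈[ W ] x
  ≈-refl = ap⟨ (λ w _ → refl) ⟩
  ≈-sym : ∀ {W x y} → x ≈[ W ] y → y ≈[ W ] x
  ≈-sym p = ap⟨ (λ w l → sym (ap p w l)) ⟩
  ≈-trans : ∀ {W x y z} → x ≈[ W ] y → y ≈[ W ] z → x ≈[ W ] z
  ≈-trans p q = ap⟨ (λ w l → trans (ap p w l) (ap q w l)) ⟩

  ≈[_]-setoid : ℕ → Setoid 0ℓ 0ℓ
  ≈[ W ]-setoid = record { Carrier = 𝔸 ; _≈_ = _≈[ W ]_ ; isEquivalence = record { refl = ≈-refl ; sym = ≈-sym ; trans = ≈-trans } }

  ≈-⊕ : ∀ {W x x' y y'} → x ≈[ W ] x' → y ≈[ W ] y' → x ⊕ y ≈[ W ] x' ⊕ y'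
  ≈-⊕ {x = x} {x'} {y} {y'} p q = ap⟨ (λ w l → trans (cf-⊕ x y w) (trans (cong₂ ℚ._+_ (ap p w l) (ap q w l)) (sym (cf-⊕ x' y' w)))) ⟩

  ≈-⊖ : ∀ {W x x' y y'} → x ≈[ W ] x' → y ≈[ W ] y' → x ⊖ y ≈[ W ] x' ⊖ y'
  ≈-⊖ {x = x} {x'} {y} {y'} p q = ap⟨ (λ w l → trans (cf-⊖ x y w) (trans (cong₂ ℚ._-_ (ap p w l) (ap q w l)) (sym (cf-⊖ x' y' w)))) ⟩

  Ord≥⇒≈𝟘 : ∀ {W x} → Ord≥ (suc W) x → x ≈[ W ] 𝟘
  Ord≥⇒≈𝟘 h = ap⟨ (λ w l → below h w (s≤s l)) ⟩

  ≈𝟘⇒Ord≥ : ∀ {W x} → x ≈[ W ] 𝟘 → Ord≥ (suc W) x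
  ≈𝟘⇒Ord≥ p = ord⟨ (λ w l → ap p w (ℕP.≤-pred l)) ⟩

  ≈⇒⊖≈𝟘 : ∀ {W x y} → x ≈[ W ] y → (x ⊖ y) ≈[ W ] 𝟘
  ≈⇒⊖≈𝟘 {x = x} {y} p = ap⟨ (λ w l → trans (cf-⊖ x y w) (trans (cong (ℚ._- cf y w) (ap p w l)) (ℚP.+-inverseʳ (cf y w)))) ⟩

  ⊖≈𝟘⇒≈ : ∀ {W x y} → (x ⊖ y) ≈[ W ] 𝟘 → x ≈[ W ] y
  ⊖≈𝟘⇒≈ {x = x} {y} p = ap⟨
      (λ w l → trans (solve 2 (λ a b → a := (a :- b) :+ b) refl (cf x w) (cf y w))
      (trans (cong (ℚ._+ cf y w) (trans (sym (cf-⊖ x y w)) (ap p w l))) (ℚP.+-identityˡ _))) ⟩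

  Bil-≈ˡ : ∀ {W} h → Superadditive h → ∀ {x x'} y → x ≈[ W ] x' → Bil h x y ≈[ W ] Bil h x' y
  Bil-≈ˡ {W} h sh {x} {x'} y p = ⊖≈𝟘⇒≈
      (Ord≥⇒≈𝟘 (Ord≥-resp (≃-sym (Bil-⊖ˡ h x x' y))
      (subst (λ k → Ord≥ k (Bil h (x ⊖ x') y)) (ℕP.+-identityʳ (suc W)) (Ord≥-Bil h sh (≈𝟘⇒Ord≥ (≈⇒⊖≈𝟘 p)) (Ord≥-0 y)))))

  Bil-≈ʳ : ∀ {W} h → Superadditive h → ∀ x {y y'} → y ≈[ W ] y' → Bil h x y ≈[ W ] Bil h x y'
  Bil-≈ʳ {W} h sh x {y} {y'} p = ⊖≈𝟘⇒≈ (Ord≥⇒≈𝟘 (Ord≥-resp (≃-sym (Bil-⊖ʳ h x y y')) (Ord≥-Bil h sh (Ord≥-0 x) (≈𝟘⇒Ord≥ (≈⇒⊖≈𝟘 p)))))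

  ⊙-≈ : ∀ {W x x' y y'} → x ≈[ W ] x' → y ≈[ W ] y' → x ⊙ y ≈[ W ] x' ⊙ y'
  ⊙-≈ {W} {x} {x'} {y} {y'} p q = ≈-trans (≃⇒≈ (⊙-Bil x y))
      (≈-trans (Bil-≈ˡ concatWords concatWords-superadditive y p)
      (≈-trans (Bil-≈ʳ concatWords concatWords-superadditive x' q) (≃⇒≈ (≃-sym (⊙-Bil x' y')))))

  ⋄-≈ : ∀ {W x x' y y'} → x ≈[ W ] x' → y ≈[ W ] y' → x ⋄ y ≈[ W ] x' ⋄ y'
  ⋄-≈ {W} {x} {x'} {y} {y'} p q = ≈-trans (Bil-≈ˡ mergeWords mergeWords-superadditive y p) (Bil-≈ʳ mergeWords mergeWords-superadditive x' q)

  cf-trunc-≤ : ∀ W x w → wt w ≤ W → cf (trunc N W x) w ≡ cf x w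
  cf-trunc-≤ W [] w w≤W = refl
  cf-trunc-≤ W ((c , v) ∷ x) w w≤W with wt v ℕ.≤? W
  ... | yes _ = cf-∷-cong c v w (cf-trunc-≤ W x w w≤W)
  ... | no v≰W = trans (cf-trunc-≤ W x w w≤W) (sym (cf-∷-≢ c v x w (λ { refl → v≰W w≤W })))

  cf-trunc-> : ∀ W x w → ¬ (wt w ≤ W) → cf (trunc N W x) w ≡ 0ℚ
  cf-trunc-> W [] w w≰W = refl
  cf-trunc-> W ((c , v) ∷ x) w w≰W with wt v ℕ.≤? W
  ... | yes v≤W = trans (cf-∷-≢ c v _ w (λ { refl → w≰W v≤W })) (cf-trunc-> W x w w≰W)
  ... | no _ = cf-trunc-> W x w w≰W

  trunc-≈ : ∀ W {x y} → x ≈[ W ] y → _≈_ N (trunc N W x) (trunc N W y)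
  trunc-≈ W {x} {y} p w with wt w ℕ.≤? W
  ... | yes w≤W = trans (cf-trunc-≤ W x w w≤W) (trans (ap p w w≤W) (sym (cf-trunc-≤ W y w w≤W)))
  ... | no w≰W = trans (cf-trunc-> W x w w≰W) (sym (cf-trunc-> W y w w≰W))

  ΣL-≈-on : ∀ {W} n {f g} → (∀ i → i < n → f i ≈[ W ] g i) → ΣL n f ≈[ W ] ΣL n g
  ΣL-≈-on zero e = ≈-refl
  ΣL-≈-on (suc n) e = ≈-⊕ (e 0 (s≤s z≤n)) (ΣL-≈-on n (λ i l → e (suc i) (s≤s l)))

  Ord≥-ΣL : ∀ {k} n f → (∀ i → i < n → Ord≥ k (f i)) → Ord≥ k (ΣL n f)
  Ord≥-ΣL zero f h = Ord≥-𝟘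
  Ord≥-ΣL (suc n) f h = Ord≥-⊕ (h 0 (s≤s z≤n)) (Ord≥-ΣL n (λ i → f (suc i)) (λ i l → h (suc i) (s≤s l)))

  Ord≥-ΣL-tail : ∀ c n k f → k ≤ n → (∀ j → Ord≥ (c + j) (f j)) → Ord≥ (c + k) (ΣL n f ⊖ ΣL k f)
  Ord≥-ΣL-tail c n k f le h = Ord≥-resp e (Ord≥-ΣL (n ∸ k) _ (λ j _ → Ord≥-mono (ℕP.+-monoʳ-≤ c (ℕP.m≤m+n k j)) (h (k + j))))
    where
    e : (ΣL n f ⊖ ΣL k f) ≃ ΣL (n ∸ k) (λ j → f (k + j))
    e = ≃-trans (⊖-cong (ΣL-split n k f le) (≃-refl {ΣL k f})) ([x⊕y]⊖x≃y (ΣL k f) _)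


module EulerOperator (N : ℕ) {{nz : NonZero N}} where
  open WeightApproximation N public

  θ-word : Wd → 𝔸
  θ-word w = fromℕ (wt w) · word w

  θ : 𝔸 → 𝔸
  θ = Lin θ-word

  θ-linear : IsLinear θ
  θ-linear = Lin-linear θ-word

  weight-scaled-word : ∀ v w → fromℕ (wt v) ℚ.* cf (word v) w ≡ fromℕ (wt w) ℚ.* cf (word v) w
  weight-scaled-word v w with v ≟w w
  ... | yes refl = refl
  ... | no _ = trans (ℚP.*-zeroʳ (fromℕ (wt v))) (sym (ℚP.*-zeroʳ (fromℕ (wt w))))

  cf-θ : ∀ x w → cf (θ x) w ≡ fromℕ (wt w) ℚ.* cf x w
  cf-θ x w = begin
      cf (θ x) w
    ≡⟨ cf-Lin θ-word x w ⟩
      Λ (λ v → cf (θ-word v) w) x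
    ≡⟨ Λ-ext x (λ v → trans (cf-· (fromℕ (wt v)) (word v) w) (weight-scaled-word v w)) ⟩
      Λ (λ v → fromℕ (wt w) ℚ.* cf (word v) w) x
    ≡⟨ Λ-scale (fromℕ (wt w)) (λ v → cf (word v) w) x ⟩
      fromℕ (wt w) ℚ.* Λ (λ v → cf (word v) w) x
    ≡⟨ cong (fromℕ (wt w) ℚ.*_) (trans (sym (cf-Lin word x w)) (at (Lin-word-id x) w)) ⟩
      fromℕ (wt w) ℚ.* cf x w
    ∎
    where open ≡-Reasoning

  Ord≥-θ : ∀ {k x} → Ord≥ k x → Ord≥ k (θ x)
  Ord≥-θ {k} {x} h = ord⟨ (λ w l → trans (cf-θ x w) (trans (cong (fromℕ (wt w) ℚ.*_) (below h w l)) (ℚP.*-zeroʳ (fromℕ (wt w))))) ⟩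

  θ-mergeWords : ∀ v u → θ (mergeWords v u) ≃ fromℕ (wt v) · mergeWords v u ⊕ fromℕ (wt u) · mergeWords v u
  θ-mergeWords [] u = ≃-refl
  θ-mergeWords ((s , i) ∷ []) [] = ≃-refl
  θ-mergeWords ((s , i) ∷ []) ((t , j) ∷ []) =
    ≃-trans (Lin-word θ-word m)
      (≃-trans (·-congˡ (word m) (trans (cong fromℕ (sym (weight-merge s i t j))) (fromℕ-+ (wt ((s , i) ∷ [])) (wt ((t , j) ∷ [])))))
               (·-distribʳ-+ (fromℕ (wt ((s , i) ∷ []))) (fromℕ (wt ((t , j) ∷ []))) (word m)))
    where
    m : Wd
    m = y₀ (suc (s + t)) ∷ []
  θ-mergeWords ((s , i) ∷ []) (_ ∷ _ ∷ _) = ≃-refl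
  θ-mergeWords (_ ∷ _ ∷ _) u = ≃-refl

  θ-⋄ : ∀ x y → θ (x ⋄ y) ≃ θ x ⋄ y ⊕ x ⋄ θ y
  θ-⋄ x y = begin
      θ (x ⋄ y)
    ≈⟨ ≃-trans (Lin-natural θ-linear (λ v → Lin (mergeWords v) y) x) (Lin-ext x (λ v → Lin-natural θ-linear (mergeWords v) y)) ⟩
      Lin (λ v → Lin (λ u → θ (mergeWords v u)) y) x
    ≈⟨ Lin-ext x (λ v → ≃-trans (Lin-ext y (λ u → θ-mergeWords v u)) (Lin-fun-⊕ _ _ y)) ⟩
      Lin (λ v → Lin (λ u → fromℕ (wt v) · mergeWords v u) y ⊕ Lin (λ u → fromℕ (wt u) · mergeWords v u) y) x
    ≈⟨ Lin-fun-⊕ (λ v → Lin (λ u → fromℕ (wt v) · mergeWords v u) y) (λ v → Lin (λ u → fromℕ (wt u) · mergeWords v u) y) x ⟩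
      Lin (λ v → Lin (λ u → fromℕ (wt v) · mergeWords v u) y) x ⊕ Lin (λ v → Lin (λ u → fromℕ (wt u) · mergeWords v u) y) x
    ≈⟨ ⊕-cong scaled-left scaled-right ⟩
      θ x ⋄ y ⊕ x ⋄ θ y
    ∎
    where
    open SR ≃-setoid
    scaled-left : Lin (λ v → Lin (λ u → fromℕ (wt v) · mergeWords v u) y) x ≃ θ x ⋄ y
    scaled-left = ≃-sym (≃-trans (Lin-comp (λ t → Lin (mergeWords t) y) θ-word x)
           (Lin-ext x (λ v → ≃-trans (Lin-· (λ t → Lin (mergeWords t) y) (fromℕ (wt v)) (word v))
               (≃-trans (·-cong (fromℕ (wt v)) (Lin-word (λ t → Lin (mergeWords t) y) v)) (≃-sym (Lin-fun-· (fromℕ (wt v)) (mergeWords v) y))))))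
    scaled-right : Lin (λ v → Lin (λ u → fromℕ (wt u) · mergeWords v u) y) x ≃ x ⋄ θ y
    scaled-right = ≃-sym (Lin-ext x (λ v → ≃-trans (Lin-comp (mergeWords v) θ-word y)
           (Lin-ext y (λ u → ≃-trans (Lin-· (mergeWords v) (fromℕ (wt u)) (word u)) (·-cong (fromℕ (wt u)) (Lin-word (mergeWords v) u))))))

  2·x≃x⊕x : ∀ X → fromℕ 2 · X ≃ X ⊕ X
  2·x≃x⊕x X = ≃-trans (·-congˡ X (fromℕ-+ 1 1)) (≃-trans (·-distribʳ-+ 1ℚ 1ℚ X) (⊕-cong (·-identityˡ X) (·-identityˡ X)))

  ⋄-right-comm : ∀ P Q R → (P ⋄ Q) ⋄ R ≃ (P ⋄ R) ⋄ Q
  ⋄-right-comm P Q R = ≃-trans (⋄-assoc P Q R) (≃-trans (⋄-cong (≃-refl {P}) (⋄-comm Q R)) (≃-sym (⋄-assoc P R Q)))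

  θ-⋄pow : ∀ x k → θ (⋄pow (suc (suc k)) x) ≃ fromℕ (suc (suc k)) · (⋄pow (suc k) x ⋄ θ x)
  θ-⋄pow x zero = ≃-trans (θ-⋄ x x) (≃-trans (⊕-cong (⋄-comm (θ x) x) (≃-refl {x ⋄ θ x})) (≃-sym (2·x≃x⊕x (x ⋄ θ x))))
  θ-⋄pow x (suc k) = begin
      θ (⋄pow (suc (suc k)) x ⋄ x)
    ≈⟨ θ-⋄ (⋄pow (suc (suc k)) x) x ⟩
      θ (⋄pow (suc (suc k)) x) ⋄ x ⊕ ⋄pow (suc (suc k)) x ⋄ θ x
    ≈⟨ ⊕-cong (≃-trans (⋄-cong (θ-⋄pow x k) (≃-refl {x}))
        (≃-trans (⋄-·ˡ (fromℕ (suc (suc k))) (⋄pow (suc k) x ⋄ θ x) x)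
        (·-cong (fromℕ (suc (suc k))) (⋄-right-comm (⋄pow (suc k) x) (θ x) x)))) (≃-refl {⋄pow (suc (suc k)) x ⋄ θ x}) ⟩
      fromℕ (suc (suc k)) · (⋄pow (suc (suc k)) x ⋄ θ x) ⊕ ⋄pow (suc (suc k)) x ⋄ θ x
    ≈⟨ ⊕-cong (≃-refl {fromℕ (suc (suc k)) · (⋄pow (suc (suc k)) x ⋄ θ x)}) (≃-sym (·-identityˡ Y)) ⟩
      fromℕ (suc (suc k)) · Y ⊕ 1ℚ · Y
    ≈⟨ ≃-sym (·-distribʳ-+ (fromℕ (suc (suc k))) 1ℚ Y) ⟩
      (fromℕ (suc (suc k)) ℚ.+ 1ℚ) · Y
    ≈⟨ ·-congˡ Y (trans (ℚP.+-comm (fromℕ (suc (suc k))) 1ℚ) (sym (fromℕ-+ 1 (suc (suc k))))) ⟩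
      fromℕ (suc (suc (suc k))) · Y
    ∎
    where
    open SR ≃-setoid
    Y : 𝔸
    Y = ⋄pow (suc (suc k)) x ⋄ θ x


module ExpLog (N : ℕ) {{nz : NonZero N}} where
  open EulerOperator N public
  open +-*-Solver

  Ord≥-𝔷 : ∀ {x} → In𝔷 x → Ord≥ 1 x
  Ord≥-𝔷 (x' , x≃x' , letters) = Ord≥-resp x≃x' (AllWeight≥⇒Ord≥ (go x' letters))
    where
    go : ∀ x → AllZetaLetters x → AllWeight≥ 1 x
    go [] [] = []
    go ((c , .(y₀ s ∷ [])) ∷ x) ((s , refl) ∷ ps) = s≤s z≤n ∷ go x ps

  Ord≥-⋄pow : ∀ {x} → Ord≥ 1 x → ∀ k → Ord≥ (suc k) (⋄pow (suc k) x)
  Ord≥-⋄pow x≥1 zero = x≥1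
  Ord≥-⋄pow {x} x≥1 (suc k) = subst (λ q → Ord≥ q (⋄pow (suc (suc k)) x)) (ℕP.+-comm (suc k) 1) (Ord≥-⋄ (Ord≥-⋄pow x≥1 k) x≥1)

  Ord≥-starPow : ∀ {x} → Ord≥ 1 x → ∀ j → Ord≥ j (starPow N j x)
  Ord≥-starPow x≥1 zero = Ord≥-0 _
  Ord≥-starPow x≥1 (suc j) = Ord≥-✶ x≥1 (Ord≥-starPow x≥1 j)

  Ord≥-catPow : ∀ {x} → Ord≥ 1 x → ∀ j → Ord≥ j (catPow N j x)
  Ord≥-catPow x≥1 zero = Ord≥-0 _
  Ord≥-catPow x≥1 (suc j) = Ord≥-⊙ x≥1 (Ord≥-catPow x≥1 j)

  In𝔷-ΣL : ∀ n f → (∀ i → In𝔷 (f i)) → In𝔷 (ΣL n f)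
  In𝔷-ΣL zero f f∈𝔷 = In𝔷-𝟘
  In𝔷-ΣL (suc n) f f∈𝔷 = In𝔷-⊕ (f∈𝔷 0) (In𝔷-ΣL n (λ i → f (suc i)) (λ i → f∈𝔷 (suc i)))

  fromℕ-suc*q≡0⇒q≡0 : ∀ k q → fromℕ (suc k) ℚ.* q ≡ 0ℚ → q ≡ 0ℚ
  fromℕ-suc*q≡0⇒q≡0 k q e = begin
      q
    ≡⟨ sym (ℚP.*-identityˡ q) ⟩
      1ℚ ℚ.* q
    ≡⟨ cong (ℚ._* q) (sym (*-inverseˡ-fromℕ (suc k))) ⟩
      ((ℤ.+ 1 ℚ./ suc k) ℚ.* fromℕ (suc k)) ℚ.* q
    ≡⟨ ℚP.*-assoc (ℤ.+ 1 ℚ./ suc k) (fromℕ (suc k)) q ⟩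
      (ℤ.+ 1 ℚ./ suc k) ℚ.* (fromℕ (suc k) ℚ.* q)
    ≡⟨ cong ((ℤ.+ 1 ℚ./ suc k) ℚ.*_) e ⟩
      (ℤ.+ 1 ℚ./ suc k) ℚ.* 0ℚ
    ≡⟨ ℚP.*-zeroʳ (ℤ.+ 1 ℚ./ suc k) ⟩
      0ℚ
    ∎
    where open ≡-Reasoning

  iF-suc : ∀ n → iF (suc n) ℚ.* fromℕ (suc n) ≡ iF n
  iF-suc n = begin
      y
    ≡⟨ sym (ℚP.*-identityʳ y) ⟩
      y ℚ.* 1ℚ
    ≡⟨ cong (y ℚ.*_) (sym (iF-inverse n)) ⟩
      y ℚ.* (iF n ℚ.* X)
    ≡⟨ solve 3 (λ y x X → y :* (x :* X) := x :* (y :* X)) refl y (iF n) X ⟩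
      iF n ℚ.* (y ℚ.* X)
    ≡⟨ cong (iF n ℚ.*_) y*X≡1 ⟩
      iF n ℚ.* 1ℚ
    ≡⟨ ℚP.*-identityʳ (iF n) ⟩
      iF n
    ∎
    where
    open ≡-Reasoning
    y X : ℚ
    y = iF (suc n) ℚ.* fromℕ (suc n)
    X = fromℕ (n !)
    y*X≡1 : y ℚ.* X ≡ 1ℚ
    y*X≡1 = trans (ℚP.*-assoc (iF (suc n)) (fromℕ (suc n)) X) (trans (cong (iF (suc n) ℚ.*_) (sym (fromℕ-* (suc n) (n !)))) (iF-inverse (suc n)))

  ⊙-contraction : ∀ {W z d} → Ord≥ 1 z → d ≈[ W ] z ⊙ d → d ≈[ W ] 𝟘
  ⊙-contraction {W} {z} {d} z≥1 d≈z⊙d = Ord≥⇒≈𝟘 (go (suc W) ℕP.≤-refl)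
    where
    go : ∀ k → k ≤ suc W → Ord≥ k d
    go zero _ = Ord≥-0 d
    go (suc k) (s≤s k≤W) = ord⟨ (λ w w<1+k →
      trans (ap d≈z⊙d w (ℕP.≤-trans (ℕP.≤-pred w<1+k) k≤W)) (below (Ord≥-⊙ z≥1 (go k (ℕP.m≤n⇒m≤1+n k≤W))) w w<1+k)) ⟩

  fixpoint-unique : ∀ {W z Y Y'} → Ord≥ 1 z → Y ≈[ W ] 𝟙 ⊕ z ⊙ Y → Y' ≈[ W ] 𝟙 ⊕ z ⊙ Y' → Y ≈[ W ] Y'
  fixpoint-unique {W} {z} {Y} {Y'} z≥1 Y≈ Y'≈ = ⊖≈𝟘⇒≈ (⊙-contraction z≥1 difference)
    where
    difference : Y ⊖ Y' ≈[ W ] z ⊙ (Y ⊖ Y')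
    difference = ≈-trans (≈-⊖ Y≈ Y'≈) (≃⇒≈ (≃-trans ([x⊕y]⊖[x⊕z]≃y⊖z 𝟙 (z ⊙ Y) (z ⊙ Y')) (≃-sym (⊙-⊖ʳ z Y Y'))))

  geoPart-equation : ∀ {W z} → Ord≥ 1 z → ∀ p → W ≤ p → geoPart N p z ≈[ W ] 𝟙 ⊕ z ⊙ geoPart N p z
  geoPart-equation {W} {z} z≥1 p W≤p = ≈-trans (≃⇒≈ padded) (≈-trans (≈-sym last≈𝟘) (≃⇒≈ shifted))
    where
    zⁿ : ℕ → 𝔸
    zⁿ k = catPow N k z
    padded : geoPart N p z ≃ ΣL (suc p) zⁿ ⊕ 𝟘
    padded = ≃-trans (sumA-ΣL (suc p) zⁿ) (≃-sym (⊕-identityʳ (ΣL (suc p) zⁿ)))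
    last≈𝟘 : ΣL (suc p) zⁿ ⊕ zⁿ (suc p) ≈[ W ] ΣL (suc p) zⁿ ⊕ 𝟘
    last≈𝟘 = ≈-⊕ (≈-refl {W} {ΣL (suc p) zⁿ}) (Ord≥⇒≈𝟘 (Ord≥-mono (s≤s W≤p) (Ord≥-catPow z≥1 (suc p))))
    shifted : ΣL (suc p) zⁿ ⊕ zⁿ (suc p) ≃ 𝟙 ⊕ z ⊙ geoPart N p z
    shifted = ≃-sym (≃-trans (⊕-cong (≃-refl {𝟙}) (≃-trans (⊙-cong (≃-refl {z}) (sumA-ΣL (suc p) zⁿ)) (ΣL-linear (⊙-linearʳ z) (suc p) zⁿ)))
                             (ΣL-last (suc p) zⁿ))

  -- S m and E m are the partial sums of exp_*(L) and exp_⋄(L) - 1.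
  module ExpPartials (L : 𝔸) (L∈𝔷 : In𝔷 L) where
    open StufflePowers L L∈𝔷 public

    L≥1 : Ord≥ 1 L
    L≥1 = Ord≥-𝔷 L∈𝔷

    Ord≥-a : ∀ j → Ord≥ j (a j)
    Ord≥-a j = Ord≥-· (iF j) (Ord≥-starPow L≥1 j)

    Ord≥-g : ∀ i → Ord≥ (suc i) (g (suc i))
    Ord≥-g i = Ord≥-· (iF (suc i)) (Ord≥-⋄pow L≥1 i)

    S E : ℕ → 𝔸
    S m = ΣL (suc m) a
    E m = ΣL m (λ i → g (suc i))

    Ord≥-E : ∀ m → Ord≥ 1 (E m)
    Ord≥-E m = Ord≥-ΣL m (λ i → g (suc i)) (λ i _ → Ord≥-mono (s≤s z≤n) (Ord≥-g i))

    S-equation : ∀ {W} m → W ≤ m → S m ≈[ W ] 𝟙 ⊕ E m ⊙ S m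
    S-equation {W} m W≤m = ≈-trans (≃⇒≈ by-recurrence) (≈-trans (≈-⊕ (≈-refl {W} {𝟙}) (ΣL-≈-on m complete-row)) (≃⇒≈ factored))
      where
      T : ℕ → ℕ → 𝔸
      T i j = g (suc i) ⊙ a j
      by-recurrence : S m ≃ 𝟙 ⊕ ΣL m (λ i → ΣL (m ∸ i) (T i))
      by-recurrence = ⊕-cong (·-identityˡ 𝟙) (≃-trans (ΣL-cong m expStar-recurrence) (ΣL-conv m T))
      complete-row : ∀ i → i < m → ΣL (m ∸ i) (T i) ≈[ W ] ΣL (suc m) (T i)
      complete-row i i<m = ≈-sym (⊖≈𝟘⇒≈ (Ord≥⇒≈𝟘 (Ord≥-mono (s≤s W≤m) (subst (λ q → Ord≥ q (ΣL (suc m) (T i) ⊖ ΣL (m ∸ i) (T i))) i+[m∸i]≡m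
        (Ord≥-ΣL-tail (suc i) (suc m) (m ∸ i) (T i) (ℕP.≤-trans (ℕP.m∸n≤m m i) (ℕP.n≤1+n m)) (λ j → Ord≥-⊙ (Ord≥-g i) (Ord≥-a j)))))))
        where
        i+[m∸i]≡m : suc i + (m ∸ i) ≡ suc m
        i+[m∸i]≡m = cong suc (ℕP.m+[n∸m]≡n (ℕP.<⇒≤ i<m))
      factored : 𝟙 ⊕ ΣL m (λ i → ΣL (suc m) (T i)) ≃ 𝟙 ⊕ E m ⊙ S m
      factored = ⊕-cong (≃-refl {𝟙}) (≃-sym (≃-trans (ΣL-linear (⊙-linearˡ (S m)) m (λ i → g (suc i)))
                                                     (ΣL-cong m (λ i → ΣL-linear (⊙-linearʳ (g (suc i))) (suc m) a))))

  θ-⊖ : ∀ x y → θ (x ⊖ y) ≃ θ x ⊖ θ y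
  θ-⊖ x y = ≃-trans (map-⊕ θ-linear x _) (⊕-cong (≃-refl {θ x}) (map-· θ-linear (ℚ.- 1ℚ) y))

  alternating-telescope : ∀ n (u : ℕ → 𝔸) → ΣL n (λ j → sgn N j · (u j ⊕ u (suc j))) ≃ u 0 ⊖ sgn N n · u n
  alternating-telescope zero u = ⟨ (λ w → sym (trans (cf-⊖ (u 0) (1ℚ · u 0) w) (trans (cong (λ q → cf (u 0) w ℚ.- q) (cf-· 1ℚ (u 0) w))
      (solve 1 (λ a → a :- con 1ℚ :* a := con 0ℚ) refl (cf (u 0) w))))) ⟩
  alternating-telescope (suc n) u = begin
      sgn N 0 · (u 0 ⊕ u 1) ⊕ ΣL n (λ j → sgn N (suc j) · (u (suc j) ⊕ u (suc (suc j))))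
    ≈⟨ ⊕-cong (≃-refl {sgn N 0 · (u 0 ⊕ u 1)}) (≃-trans (ΣL-cong n sgn-suc) (≃-sym (ΣL-linear (·-linear (ℚ.- 1ℚ)) n _))) ⟩
      sgn N 0 · (u 0 ⊕ u 1) ⊕ (ℚ.- 1ℚ) · ΣL n (λ j → sgn N j · (u (suc j) ⊕ u (suc (suc j))))
    ≈⟨ ⊕-cong (≃-refl {sgn N 0 · (u 0 ⊕ u 1)}) (·-cong (ℚ.- 1ℚ) (alternating-telescope n (λ j → u (suc j)))) ⟩
      1ℚ · (u 0 ⊕ u 1) ⊖ (u 1 ⊖ sgn N n · u (suc n))
    ≈⟨ ⟨ (λ w → coefficients w) ⟩ ⟩
      u 0 ⊖ sgn N (suc n) · u (suc n)
    ∎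
    where
    open SR ≃-setoid
    sgn-suc : ∀ j → sgn N (suc j) · (u (suc j) ⊕ u (suc (suc j))) ≃ (ℚ.- 1ℚ) · (sgn N j · (u (suc j) ⊕ u (suc (suc j))))
    sgn-suc j = ≃-trans (·-congˡ _ (trans (cong ℚ.-_ (sym (ℚP.*-identityˡ (sgn N j)))) (ℚP.neg-distribˡ-* 1ℚ (sgn N j))))
        (≃-sym (·-assoc (ℚ.- 1ℚ) (sgn N j) _))
    coefficients : ∀ w → cf (1ℚ · (u 0 ⊕ u 1) ⊖ (u 1 ⊖ sgn N n · u (suc n))) w ≡ cf (u 0 ⊖ sgn N (suc n) · u (suc n)) w
    coefficients w =
      trans (cf-⊖ (1ℚ · (u 0 ⊕ u 1)) _ w) (trans (cong₂ ℚ._-_ (trans (cf-· 1ℚ (u 0 ⊕ u 1) w) (cong (1ℚ ℚ.*_) (cf-⊕ (u 0) (u 1) w)))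
                                                               (trans (cf-⊖ (u 1) _ w)
                                                                   (cong (λ q → cf (u 1) w ℚ.- q) (cf-· (sgn N n) (u (suc n)) w))))
        (trans (solve 4 (λ a b c s → con 1ℚ :* (a :+ b) :- (b :- s :* c) := a :- (:- s) :* c) refl (cf (u 0) w) (cf (u 1) w)
            (cf (u (suc n)) w) (sgn N n))
          (sym (trans (cf-⊖ (u 0) _ w) (cong (λ q → cf (u 0) w ℚ.- q) (cf-· (ℚ.- sgn N n) (u (suc n)) w))))))

  -- θ turns the partial sums of log_⋄(1+z) into Σ (-1)^j ψ j, which telescopes against z ⋄ _.
  module ExpOfLog (z : 𝔸) (z∈𝔷 : In𝔷 z) where
    z≥1 : Ord≥ 1 z
    z≥1 = Ord≥-𝔷 z∈𝔷

    ψ : ℕ → 𝔸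
    ψ zero = θ z
    ψ (suc j) = ⋄pow (suc j) z ⋄ θ z

    θ-⋄pow-z : ∀ j → θ (⋄pow (suc j) z) ≃ fromℕ (suc j) · ψ j
    θ-⋄pow-z zero = ≃-sym (·-identityˡ (θ z))
    θ-⋄pow-z (suc j) = θ-⋄pow z j

    z⋄ψ : ∀ j → z ⋄ ψ j ≃ ψ (suc j)
    z⋄ψ zero = ≃-refl
    z⋄ψ (suc j) = ≃-trans (≃-sym (⋄-assoc z (⋄pow (suc j) z) (θ z))) (⋄-cong (⋄-comm z (⋄pow (suc j) z)) (≃-refl {θ z}))

    logCoeff : ℕ → ℚ
    logCoeff j = sgn N j ℚ.* (ℤ.+ 1 ℚ./ suc j)

    Lg : ℕ → 𝔸
    Lg n = logPart N n z

    Lg≃ΣL : ∀ n → Lg n ≃ ΣL n (λ j → logCoeff j · ⋄pow (suc j) z)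
    Lg≃ΣL n = ≃-trans (sumA-ΣL n (λ j → logCoeff j · circPow N (suc j) z)) (ΣL-cong n (λ j → ·-cong (logCoeff j) (circPow≃⋄pow z∈𝔷 (suc j))))

    In𝔷-Lg : ∀ n → In𝔷 (Lg n)
    In𝔷-Lg n = In𝔷-resp (Lg≃ΣL n) (In𝔷-ΣL n _ (λ j → In𝔷-· (logCoeff j) (In𝔷-⋄pow z∈𝔷 j)))

    θ-Lg : ∀ n → θ (Lg n) ≃ ΣL n (λ j → sgn N j · ψ j)
    θ-Lg n = ≃-trans (resp-≃ θ-linear (Lg≃ΣL n)) (≃-trans (ΣL-linear θ-linear n (λ j → logCoeff j · ⋄pow (suc j) z)) (ΣL-cong n θ-term))
      where
      θ-term : ∀ j → θ (logCoeff j · ⋄pow (suc j) z) ≃ sgn N j · ψ j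
      θ-term j = ≃-trans (map-· θ-linear (logCoeff j) (⋄pow (suc j) z)) (≃-trans (·-cong (logCoeff j) (θ-⋄pow-z j))
        (≃-trans (·-assoc (logCoeff j) (fromℕ (suc j)) (ψ j)) (·-congˡ (ψ j)
          (trans (ℚP.*-assoc (sgn N j) (ℤ.+ 1 ℚ./ suc j) (fromℕ (suc j)))
              (trans (cong (sgn N j ℚ.*_) (*-inverseˡ-fromℕ (suc j))) (ℚP.*-identityʳ (sgn N j)))))))

    Φ : 𝔸 → 𝔸
    Φ e = θ e ⊕ z ⋄ θ e

    Φ-Lg : ∀ n → Φ (Lg n) ≃ ψ 0 ⊖ sgn N n · ψ n
    Φ-Lg n = ≃-trans (⊕-cong (θ-Lg n) (≃-trans (⋄-cong (≃-refl {z}) (θ-Lg n)) (≃-trans (ΣL-linear (⋄-linearʳ z) n (λ j → sgn N j · ψ j))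
                                          (ΣL-cong n (λ j → ≃-trans (⋄-·ʳ (sgn N j) z (ψ j)) (·-cong (sgn N j) (z⋄ψ j)))))))
       (≃-trans (≃-sym (ΣL-⊕ n (λ j → sgn N j · ψ j) (λ j → sgn N j · ψ (suc j))))
                (≃-trans (ΣL-cong n (λ j → ≃-sym (·-distribˡ-⊕ (sgn N j) (ψ j) (ψ (suc j))))) (alternating-telescope n ψ)))

    Φ-Lg≈θz : ∀ {W} n → W ≤ n → Φ (Lg (suc n)) ≈[ W ] θ z
    Φ-Lg≈θz {W} n W≤n = ≈-trans (≃⇒≈ (Φ-Lg (suc n))) (≈-trans (≈-⊕ (≈-refl {W} {θ z}) (Ord≥⇒≈𝟘 tail≥W+1)) (≃⇒≈ (⊕-identityʳ (θ z))))
      where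
      tail≥W+1 : Ord≥ (suc W) ((ℚ.- 1ℚ) · (sgn N (suc n) · ψ (suc n)))
      tail≥W+1 = Ord≥-mono (ℕP.≤-trans (s≤s W≤n) (ℕP.m≤m+n (suc n) 1))
                           (Ord≥-· (ℚ.- 1ℚ) (Ord≥-· (sgn N (suc n)) (Ord≥-⋄ (Ord≥-⋄pow z≥1 n) (Ord≥-θ z≥1))))

    Φ-⊖ : ∀ e e' → Φ (e ⊖ e') ≃ Φ e ⊖ Φ e'
    Φ-⊖ e e' = ≃-trans (⊕-cong (θ-⊖ e e') (≃-trans (⋄-cong (≃-refl {z}) (θ-⊖ e e')) (⋄-⊖ʳ z (θ e) (θ e'))))
                       (⊕-⊖-interchange (θ e) (z ⋄ θ e) (θ e') (z ⋄ θ e'))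

    -- θ scales the weight-k part by k, so a solution of Φ d = d ⋄ θ z is determined weight by weight.
    euler-contraction : ∀ {W d} → Ord≥ 1 d → Φ d ≈[ W ] d ⋄ θ z → d ≈[ W ] 𝟘
    euler-contraction {W} {d} d≥1 Φd≈ = Ord≥⇒≈𝟘 (go W ℕP.≤-refl)
      where
      go : ∀ k → k ≤ W → Ord≥ (suc k) d
      go zero _ = d≥1
      go (suc k) 1+k≤W = ord⟨ (λ w w<2+k → at-weight w w<2+k (ℕP.m≤n⇒m<n∨m≡n (ℕP.≤-pred w<2+k))) ⟩
        where
        d≥1+k : Ord≥ (suc k) d
        d≥1+k = go k (ℕP.≤-trans (ℕP.n≤1+n k) 1+k≤W)
        at-weight : ∀ w → wt w < suc (suc k) → (wt w < suc k) ⊎ (wt w ≡ suc k) → cf d w ≡ 0ℚ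
        at-weight w _ (inj₁ w<1+k) = below d≥1+k w w<1+k
        at-weight w w<2+k (inj₂ wt≡1+k) = fromℕ-suc*q≡0⇒q≡0 k (cf d w) (begin
            fromℕ (suc k) ℚ.* cf d w
          ≡⟨ cong (λ q → fromℕ q ℚ.* cf d w) (sym wt≡1+k) ⟩
            fromℕ (wt w) ℚ.* cf d w
          ≡⟨ sym (trans (cf-⊕ (θ d) (z ⋄ θ d) w) (trans (cong₂ ℚ._+_ (cf-θ d w) (below (Ord≥-⋄ z≥1 (Ord≥-θ d≥1+k)) w w<2+k))
                                                        (ℚP.+-identityʳ _))) ⟩
            cf (Φ d) w
          ≡⟨ ap Φd≈ w (subst (_≤ W) (sym wt≡1+k) 1+k≤W) ⟩
            cf (d ⋄ θ z) w
          ≡⟨ below (subst (λ q → Ord≥ q (d ⋄ θ z)) (ℕP.+-comm (suc k) 1) (Ord≥-⋄ d≥1+k (Ord≥-θ z≥1))) w w<2+k ⟩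
            0ℚ
          ∎)
          where open ≡-Reasoning

    euler-equation-unique : ∀ {W e e'} → Ord≥ 1 e → Ord≥ 1 e' → Φ e ≈[ W ] θ z ⊕ e ⋄ θ z → Φ e' ≈[ W ] θ z ⊕ e' ⋄ θ z → e ≈[ W ] e'
    euler-equation-unique {W} {e} {e'} e≥1 e'≥1 Φe≈ Φe'≈ = ⊖≈𝟘⇒≈ (euler-contraction (Ord≥-⊕ e≥1 (Ord≥-· (ℚ.- 1ℚ) e'≥1)) difference)
      where
      difference : Φ (e ⊖ e') ≈[ W ] (e ⊖ e') ⋄ θ z
      difference = ≈-trans (≃⇒≈ (Φ-⊖ e e')) (≈-trans (≈-⊖ Φe≈ Φe'≈)
                     (≃⇒≈ (≃-trans ([x⊕y]⊖[x⊕z]≃y⊖z (θ z) (e ⋄ θ z) (e' ⋄ θ z)) (≃-sym (⋄-⊖ˡ e e' (θ z))))))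

    module _ (n : ℕ) where
      open ExpPartials (Lg (suc n)) (In𝔷-Lg (suc n))

      private
        Λₙ : 𝔸
        Λₙ = Lg (suc n)

      θ-g : ∀ i → θ (g (suc (suc i))) ≃ g (suc i) ⋄ θ Λₙ
      θ-g i = ≃-trans (map-· θ-linear (iF (suc (suc i))) (⋄pow (suc (suc i)) Λₙ)) (≃-trans (·-cong (iF (suc (suc i))) (θ-⋄pow Λₙ i))
        (≃-trans (·-assoc (iF (suc (suc i))) (fromℕ (suc (suc i))) _)
          (≃-trans (·-congˡ (⋄pow (suc i) Λₙ ⋄ θ Λₙ) (iF-suc (suc i))) (≃-sym (⋄-·ˡ (iF (suc i)) (⋄pow (suc i) Λₙ) (θ Λₙ))))))

      θ-E : ∀ m → θ (E (suc m)) ≃ θ Λₙ ⊕ E m ⋄ θ Λₙ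
      θ-E m = ≃-trans (map-⊕ θ-linear (g 1) _) (⊕-cong (≃-trans (map-· θ-linear (iF 1) Λₙ) (·-identityˡ (θ Λₙ)))
         (≃-trans (ΣL-linear θ-linear m (λ i → g (suc (suc i))))
             (≃-trans (ΣL-cong m θ-g) (≃-sym (ΣL-linear (⋄-linearˡ (θ Λₙ)) m (λ i → g (suc i)))))))

      θ-E≈ : ∀ {W} m → W ≤ m → θ (E (suc m)) ≈[ W ] θ Λₙ ⊕ E (suc m) ⋄ θ Λₙ
      θ-E≈ {W} m W≤m = ≈-trans (≃⇒≈ (θ-E m))
          (≈-⊕ (≈-refl {W} {θ Λₙ}) (≈-sym (≈-trans (≃⇒≈ split-last) (≈-trans drop-last (≃⇒≈ (⊕-identityʳ (E m ⋄ θ Λₙ)))))))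
        where
        split-last : E (suc m) ⋄ θ Λₙ ≃ E m ⋄ θ Λₙ ⊕ g (suc m) ⋄ θ Λₙ
        split-last = ≃-trans (⋄-cong (ΣL-last m (λ i → g (suc i))) (≃-refl {θ Λₙ})) (⋄-⊕ˡ (E m) (g (suc m)) (θ Λₙ))
        drop-last : E m ⋄ θ Λₙ ⊕ g (suc m) ⋄ θ Λₙ ≈[ W ] E m ⋄ θ Λₙ ⊕ 𝟘
        drop-last = ≈-⊕ (≈-refl {W} {E m ⋄ θ Λₙ}) (Ord≥⇒≈𝟘 (Ord≥-mono (ℕP.≤-trans (s≤s W≤m) (ℕP.m≤m+n (suc m) 1)) (Ord≥-⋄ (Ord≥-g m) (Ord≥-θ L≥1))))

      Φ-E : ∀ {W} m → W ≤ m → W ≤ n → Φ (E (suc m)) ≈[ W ] θ z ⊕ E (suc m) ⋄ θ z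
      Φ-E {W} m W≤m W≤n = begin
          θ e ⊕ z ⋄ θ e
        ≈⟨ ≈-⊕ (θ-E≈ m W≤m) (⋄-≈ (≈-refl {W} {z}) (θ-E≈ m W≤m)) ⟩
          (θ Λₙ ⊕ e ⋄ θ Λₙ) ⊕ z ⋄ (θ Λₙ ⊕ e ⋄ θ Λₙ)
        ≈⟨ ≃⇒≈ regroup ⟩
          Φ Λₙ ⊕ e ⋄ Φ Λₙ
        ≈⟨ ≈-⊕ (Φ-Lg≈θz n W≤n) (⋄-≈ (≈-refl {W} {e}) (Φ-Lg≈θz n W≤n)) ⟩
          θ z ⊕ e ⋄ θ z
        ∎
        where
        open SR ≈[ W ]-setoid
        e : 𝔸
        e = E (suc m)
        regroup : (θ Λₙ ⊕ e ⋄ θ Λₙ) ⊕ z ⋄ (θ Λₙ ⊕ e ⋄ θ Λₙ) ≃ Φ Λₙ ⊕ e ⋄ Φ Λₙ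
        regroup = ≃-trans (⊕-cong (≃-refl {θ Λₙ ⊕ e ⋄ θ Λₙ}) (≃-trans (⋄-⊕ʳ z (θ Λₙ) (e ⋄ θ Λₙ)) (⊕-cong (≃-refl {z ⋄ θ Λₙ}) ⋄-left-comm)))
                   (≃-trans (⊕-interchange (θ Λₙ) (e ⋄ θ Λₙ) (z ⋄ θ Λₙ) (e ⋄ (z ⋄ θ Λₙ))) (⊕-cong (≃-refl {Φ Λₙ}) (≃-sym (⋄-⊕ʳ e (θ Λₙ) (z ⋄ θ Λₙ)))))
          where
          ⋄-left-comm : z ⋄ (e ⋄ θ Λₙ) ≃ e ⋄ (z ⋄ θ Λₙ)
          ⋄-left-comm = ≃-trans (≃-sym (⋄-assoc z e (θ Λₙ))) (≃-trans (⋄-cong (⋄-comm z e) (≃-refl {θ Λₙ})) (⋄-assoc e z (θ Λₙ)))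

      E≈z : ∀ {W} m → W ≤ m → W ≤ n → E (suc m) ≈[ W ] z
      E≈z m W≤m W≤n = euler-equation-unique (Ord≥-E (suc m)) z≥1 (Φ-E m W≤m W≤n) ≈-refl

    expLogPart≈geoPart : ∀ W m n p → W ≤ m → W ≤ n → W ≤ p → expPart N (suc m) (Lg (suc n)) ≈[ W ] geoPart N p z
    expLogPart≈geoPart W m n p W≤m W≤n W≤p = ≈-trans (≃⇒≈ (sumA-ΣL (suc (suc m)) E.a)) (fixpoint-unique z≥1 S≈ (geoPart-equation z≥1 p W≤p))
      where
      module E = ExpPartials (Lg (suc n)) (In𝔷-Lg (suc n))
      S≈ : E.S (suc m) ≈[ W ] 𝟙 ⊕ z ⊙ E.S (suc m)
      S≈ = ≈-trans (E.S-equation (suc m) (ℕP.≤-trans W≤m (ℕP.n≤1+n m))) (≈-⊕ (≈-refl {W} {𝟙}) (⊙-≈ (E≈z n m W≤m W≤n) (≈-refl {W} {E.S (suc m)})))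

  expLog-geometric : ∀ z → In𝔷 z → ∀ (W : ℕ) → ∃ λ (M : ℕ) → ∀ (m n p : ℕ) → M ≤ m → M ≤ n → M ≤ p →
        _≈_ N (trunc N W (expPart N m (logPart N n z))) (trunc N W (geoPart N p z))
  expLog-geometric z z∈𝔷 W = suc W , truncations-agree
    where
    truncations-agree : ∀ (m n p : ℕ) → suc W ≤ m → suc W ≤ n → suc W ≤ p →
      _≈_ N (trunc N W (expPart N m (logPart N n z))) (trunc N W (geoPart N p z))
    truncations-agree (suc m) (suc n) p (s≤s W≤m) (s≤s W≤n) W<p =
      trunc-≈ W (ExpOfLog.expLogPart≈geoPart z z∈𝔷 W m n p W≤m W≤n (ℕP.≤-trans (ℕP.n≤1+n W) W<p))

mainTheorem10 : (N : ℕ) {{nz : NonZero N}} (z : A N) → _∈𝔷 N z →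
    IsInverseP N (expStarPS N z) (twoMinusExpCirc N z)
    × (∀ (W : ℕ) → ∃ λ (M : ℕ) → ∀ (m n p : ℕ) → M ≤ m → M ≤ n → M ≤ p →
        _≈_ N (trunc N W (expPart N m (logPart N n z))) (trunc N W (geoPart N p z)))
mainTheorem10 N z z∈𝔷 = ExpStuffle.expStar-inverse N z z∈𝔷′ , ExpLog.expLog-geometric N z z∈𝔷′
  where
  z∈𝔷′ : Merge.In𝔷 N z
  z∈𝔷′ = Merge.∈𝔷⇒In𝔷 N z∈𝔷
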